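{- Let $D$ be a transitive dessin (an element of $\mathcal{D}$), regarded as an element of the $\mathbb{Q}$-algebra $\mathbb{Q}\mathcal{D}$ described in the context. Then the minimal polynomial $P_D(x)\in\mathbb{Q}[x]$ of $D$ factors over $\mathbb{Q}$ as a product of linear factors.
   Context: A dessin is an ordered pair $(\alpha,\beta)$ of permutations of a nonempty finite set $E$ (the edges), considered up to relabelling of the edges: $(\alpha,\beta)$ on $E$ and $(\alpha',\beta')$ on $E'$ are identified if there is a bijection $f:E\to E'$ with $f\alpha=\alpha' f$ and $f\beta=\beta' f$. The product of dessins $(\alpha,\beta)$ on $E$ and $(\alpha',\beta')$ on $E'$ is the dessin $(\alpha\times\alpha',\beta\times\beta')$ on $E\times E'$. A dessin is irreducible if the group generated by $\alpha,\beta$ acts transitively on $E$; every dessin decomposes into irreducible components, namely the restrictions of $(\alpha,\beta)$ to the orbits of $\langle\alpha,\beta\rangle$. Let $\mathcal{D}$ be the set of (relabelling classes of) irreducible dessins, and let $\mathbb{Q}\mathcal{D}$ be the $\mathbb{Q}$-vector space of finite formal $\mathbb{Q}$-linear combinations of elements of $\mathcal{D}$. It is a commutative ring with multiplication defined on basis elements by $D\cdot D'=$ the formal sum (with multiplicity) of the irreducible components of the product dessin of $D$ and $D'$, extended bilinearly; its unit is the dessin $1$ with one edge. For each $\psi\in\mathbb{Q}\mathcal{D}$ the subalgebra $\mathbb{Q}[\psi]$ generated by $\psi$ is finite dimensional over $\mathbb{Q}$, so $\psi$ has a minimal polynomial $P_\psi(x)$: the monic generator of the kernel of $\mathbb{Q}[x]\to\mathbb{Q}\mathcal{D}$,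 $x\mapsto\psi$. -}

module Defs where

open import Data.Nat.Base as ℕ using (ℕ; zero; suc; _<_)
open import Data.Integer.Base using (+_)
open import Data.Rational.Base as ℚ using (ℚ; 0ℚ; 1ℚ)
open import Data.Fin.Base using (Fin; zero; suc; remQuot; combine)
open import Data.Fin.Properties using (remQuot-combine; combine-remQuot)
open import Data.Fin.Permutation using (Permutation′; permutation; _⟨$⟩ʳ_; _⟨$⟩ˡ_; inverseˡ; inverseʳ)
open import Data.Product.Base using (Σ; ∃; _×_; _,_; proj₁; proj₂)
open import Data.Sum.Base using (_⊎_)
open import Data.List.Base using (List; []; _∷_; map)
open import Data.Bool.Base using (Bool; true; false)
open import Function.Bundles using (_↔_; Inverse; _⇔_)
open import Function.Definitions using (Injective)
open import Relation.Binary.PropositionalEquality using (_≡_; refl; cong; cong₂; trans)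
open import Relation.Binary.Construct.Closure.ReflexiveTransitive using (Star)

-- Dessins.  The edge set is Fin size (every finite set is in bijection
-- with some Fin n, and dessins are taken up to relabelling anyway);
-- nonemptiness is witnessed by a chosen edge.

record Dessin : Set where
  field
    size  : ℕ
    edge₀ : Fin size
    α     : Permutation′ size
    β     : Permutation′ size

open Dessin public

record _≅_ (D D′ : Dessin) : Set where
  field
    f    : Fin (size D) ↔ Fin (size D′)
    f-α  : ∀ e → Inverse.to f (α D ⟨$⟩ʳ e) ≡ α D′ ⟨$⟩ʳ Inverse.to f e
    f-β  : ∀ e → Inverse.to f (β D ⟨$⟩ʳ e) ≡ β D′ ⟨$⟩ʳ Inverse.to f e

Step : (D : Dessin) → Fin (size D) → Fin (size D) → Set
Step D x y = (y ≡ α D ⟨$⟩ʳ x) ⊎ (y ≡ α D ⟨$⟩ˡ x) ⊎ (y ≡ β D ⟨$⟩ʳ x) ⊎ (y ≡ β D ⟨$⟩ˡ x)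

-- Irreducible (transitive): the group ⟨α,β⟩ acts transitively on the edges.
Irreducible : Dessin → Set
Irreducible D = ∀ x y → Star (Step D) x y

-- Product of dessins, on Fin (n * m) ≅ Fin n × Fin m.

module _ {n m : ℕ} where
  liftPair : (Fin n → Fin n) → (Fin m → Fin m) → Fin (n ℕ.* m) → Fin (n ℕ.* m)
  liftPair h k i = combine (h (proj₁ (remQuot {n} m i))) (k (proj₂ (remQuot {n} m i)))

  liftPair-inv : ∀ h k h′ k′ → (∀ a → h (h′ a) ≡ a) → (∀ b → k (k′ b) ≡ b) →
                 ∀ i → liftPair h k (liftPair h′ k′ i) ≡ i
  liftPair-inv h k h′ k′ hh kk i =
    trans (cong (λ p → combine (h (proj₁ p)) (k (proj₂ p)))
                (remQuot-combine {n} {m} (h′ (proj₁ (remQuot {n} m i))) (k′ (proj₂ (remQuot {n} m i)))))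
          (trans (cong₂ combine (hh _) (kk _)) (combine-remQuot {n} m i))

prodPerm : ∀ {n m} → Permutation′ n → Permutation′ m → Permutation′ (n ℕ.* m)
prodPerm {n} {m} π ρ =
  permutation (liftPair (π ⟨$⟩ʳ_) (ρ ⟨$⟩ʳ_)) (liftPair (π ⟨$⟩ˡ_) (ρ ⟨$⟩ˡ_))
    (liftPair-inv (π ⟨$⟩ʳ_) (ρ ⟨$⟩ʳ_) (π ⟨$⟩ˡ_) (ρ ⟨$⟩ˡ_) (λ a → inverseʳ π) (λ b → inverseʳ ρ))
    (liftPair-inv (π ⟨$⟩ˡ_) (ρ ⟨$⟩ˡ_) (π ⟨$⟩ʳ_) (ρ ⟨$⟩ʳ_) (λ a → inverseˡ π) (λ b → inverseˡ ρ))

_⊗_ : Dessin → Dessin → Dessin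
D ⊗ D′ = record
  { size  = size D ℕ.* size D′
  ; edge₀ = combine (edge₀ D) (edge₀ D′)
  ; α     = prodPerm (α D) (α D′)
  ; β     = prodPerm (β D) (β D′)
  }

𝟙 : Dessin
𝟙 = record { size = 1 ; edge₀ = zero ; α = permutation (λ x → x) (λ x → x) (λ _ → refl) (λ _ → refl)
                                   ; β = permutation (λ x → x) (λ x → x) (λ _ → refl) (λ _ → refl) }

-- A component is an irreducible dessin C together with an injective
-- map of edges commuting with α and β; its image is then an orbit of
-- ⟨α,β⟩ and C is (a relabelling of) the restriction to that orbit.

record Component (X : Dessin) : Set where
  field
    dessin      : Dessin
    irreducible : Irreducible dessin
    emb         : Fin (size dessin) → Fin (size X)
    emb-inj     : Injective _≡_ _≡_ emb
    emb-α       : ∀ e → emb (α dessin ⟨$⟩ʳ e) ≡ α X ⟨$⟩ʳ emb e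
    emb-β       : ∀ e → emb (β dessin ⟨$⟩ʳ e) ≡ β X ⟨$⟩ʳ emb e

record Decomposition (X : Dessin) : Set where
  field
    count    : ℕ
    comp     : Fin count → Component X
    cover    : ∀ x → Σ (Fin count) λ i → Σ (Fin (size (Component.dessin (comp i)))) λ e →
                 Component.emb (comp i) e ≡ x
    disjoint : ∀ i j e e′ → Component.emb (comp i) e ≡ Component.emb (comp j) e′ → i ≡ j

countTrue : ∀ {k} → (Fin k → Bool) → ℕ
countTrue {zero}  s = 0
countTrue {suc k} s with s zero
... | true  = suc (countTrue (λ i → s (suc i)))
... | false = countTrue (λ i → s (suc i))

MultIs : Dessin → Dessin → ℕ → Set
MultIs E X k =
  Σ (Decomposition X) λ dec →
  Σ (Fin (Decomposition.count dec) → Bool) λ s →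
    (∀ i → (s i ≡ true) ⇔ (Component.dessin (Decomposition.comp dec i) ≅ E))
    × countTrue s ≡ k

-- The algebra ℚ𝒟.  An element is represented by a finite formal
-- ℚ-combination Σ qᵢ [Xᵢ] of dessins; a (possibly reducible) dessin X
-- stands for the sum of its irreducible components, as in ℚ𝒟.

QD : Set
QD = List (ℚ × Dessin)

[_] : Dessin → QD
[ D ] = (1ℚ , D) ∷ []

mulBy : Dessin → QD → QD
mulBy D = map (λ { (q , X) → (q , D ⊗ X) })

ℕtoℚ : ℕ → ℚ
ℕtoℚ k = (+ k) ℚ./ 1

data CoeffIs (E : Dessin) : QD → ℚ → Set where
  nil  : CoeffIs E [] 0ℚ
  cons : ∀ {q X u c k} → MultIs E X k → CoeffIs E u c →
         CoeffIs E ((q , X) ∷ u) (q ℚ.* ℕtoℚ k ℚ.+ c)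

IsZero : QD → Set
IsZero u = ∀ E → Irreducible E → ∀ c → CoeffIs E u c → c ≡ 0ℚ

-- Polynomials over ℚ: coefficient lists, lowest degree first.

Poly : Set
Poly = List ℚ

coeff : Poly → ℕ → ℚ
coeff []       _       = 0ℚ
coeff (c ∷ cs) zero    = c
coeff (c ∷ cs) (suc i) = coeff cs i

-- equality of polynomials (ignores trailing zeros)
_≈ₚ_ : Poly → Poly → Set
p ≈ₚ q = ∀ i → coeff p i ≡ coeff q i

_+ₚ_ : Poly → Poly → Poly
[]       +ₚ q        = q
(a ∷ p)  +ₚ []       = a ∷ p
(a ∷ p)  +ₚ (b ∷ q)  = (a ℚ.+ b) ∷ (p +ₚ q)

_*ₚ_ : Poly → Poly → Poly
[]      *ₚ q = []
(a ∷ p) *ₚ q = map (a ℚ.*_) q +ₚ (0ℚ ∷ (p *ₚ q))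

_∣ₚ_ : Poly → Poly → Set
p ∣ₚ q = Σ Poly λ r → (p *ₚ r) ≈ₚ q

Monic : Poly → Set
Monic p = Σ ℕ λ n → coeff p n ≡ 1ℚ × (∀ m → n < m → coeff p m ≡ 0ℚ)

evalAt : Poly → Dessin → QD
evalAt []       D = []
evalAt (c ∷ cs) D = (c , 𝟙) ∷ mulBy D (evalAt cs D)

Annihilates : Poly → Dessin → Set
Annihilates p D = IsZero (evalAt p D)

IsMinPoly : Poly → Dessin → Set
IsMinPoly p D = Monic p × Annihilates p D × (∀ q → Annihilates q D → p ∣ₚ q)

linear : ℚ → Poly
linear r = ℚ.- r ∷ 1ℚ ∷ []

prodₚ : List Poly → Poly
prodₚ []       = 1ℚ ∷ []
prodₚ (p ∷ ps) = p *ₚ prodₚ ps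

SplitsOverℚ : Poly → Set
SplitsOverℚ p = Σ (List ℚ) λ rs → p ≈ₚ prodₚ (map linear rs)

module Submission where

-- For irreducible E, the hom-mark of a dessin X at E is the number of edges
-- x of X such that some homomorphism E → X sends the base edge of E to x.
-- Pointed homomorphisms into a product D ⊗ X are pairs of pointed
-- homomorphisms, so the hom-mark is multiplicative; extended linearly it is a
-- ring homomorphism ℚ𝒟 → ℚ, and the hom-mark of p(D) is p(h) where h is the
-- hom-mark of D, an integer in [0, size D].  Hence every hom-mark of Q(D)
-- vanishes for Q(x) = ∏_{h ≤ size D} (x - h).
-- The marks separate the elements of ℚ𝒟.  Replacing homomorphisms by
-- embeddings gives embedding marks; by strong induction on the size of E,
-- peeling off the images of non-injective homomorphisms (smaller irreducible
-- dessins), vanishing hom-marks force vanishing embedding marks.  The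
-- embedding mark at E of an element is a positive integer times its
-- coefficient at E.  So Q(D) = 0 in ℚ𝒟, the minimal polynomial divides Q, and
-- a monic divisor of a product of linear factors is itself such a product.

open import Defs
open import Data.Bool.Base using (Bool; true; false; _∧_; not; if_then_else_)
import Data.Bool.Properties as BoolP
open import Data.Empty using (⊥; ⊥-elim)
open import Data.Fin.Base using (Fin; zero; suc; _↑ˡ_; _↑ʳ_; combine; remQuot)
open import Data.Fin.Permutation using (Permutation′; permutation; _⟨$⟩ʳ_; _⟨$⟩ˡ_; inverseˡ; inverseʳ)
import Data.Fin.Properties as FinP
import Data.Integer.Base as ℤ
import Data.Integer.Properties as ℤP
open import Data.List.Base using (List; []; _∷_; map; length; applyUpTo)
open import Data.List.Membership.Propositional using (_∈_)
open import Data.List.Membership.Propositional.Properties using (∈-applyUpTo⁺)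
open import Data.List.Relation.Unary.Any using (here; there)
open import Data.Nat.Base as ℕ using (ℕ; zero; suc; _<_; _≤_; s≤s; z≤n)
import Data.Nat.Properties as ℕP
open import Algebra.Properties.CommutativeSemigroup ℕP.+-commutativeSemigroup using () renaming (interchange to +-interchange)
open import Data.Product.Base using (Σ; _×_; _,_; proj₁; proj₂)
open import Data.Rational.Base as ℚ using (ℚ; 0ℚ; 1ℚ; _+_; _*_; -_; 1/_; toℚᵘ)
import Data.Rational.Properties as ℚP
open import Data.Rational.Solver using (module +-*-Solver)
open +-*-Solver using (solve; _:+_; _:*_; :-_; _:=_; con)
import Data.Rational.Unnormalised.Base as ℚᵘ
import Data.Rational.Unnormalised.Properties as ℚᵘP
open import Data.Sum.Base using (_⊎_; inj₁; inj₂)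
open import Function.Base using (_∘_; id)
open import Function.Bundles using (_⇔_; Inverse; Equivalence; mk⇔)
open import Function.Definitions using (Injective)
open import Relation.Binary.Construct.Closure.ReflexiveTransitive using (Star; ε; _◅_)
open import Relation.Binary.Definitions using (tri<; tri≈; tri>)
open import Relation.Binary.PropositionalEquality
open import Relation.Nullary using (¬_; yes; no; Dec)
open import Relation.Nullary.Decidable using (does; dec-true; dec-false; does-⇔; map′; _×-dec_; _→-dec_; ¬?)

shift : Poly → Poly
shift p = 0ℚ ∷ p

scale : ℚ → Poly → Poly
scale a = map (a *_)

coeff-+ₚ : ∀ p q i → coeff (p +ₚ q) i ≡ coeff p i + coeff q i
coeff-+ₚ []      q       i       = sym (ℚP.+-identityˡ (coeff q i))
coeff-+ₚ (a ∷ p) []      i       = sym (ℚP.+-identityʳ (coeff (a ∷ p) i))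
coeff-+ₚ (a ∷ p) (b ∷ q) zero    = refl
coeff-+ₚ (a ∷ p) (b ∷ q) (suc i) = coeff-+ₚ p q i

coeff-scale : ∀ a q i → coeff (scale a q) i ≡ a * coeff q i
coeff-scale a []      i       = sym (ℚP.*-zeroʳ a)
coeff-scale a (b ∷ q) zero    = refl
coeff-scale a (b ∷ q) (suc i) = coeff-scale a q i

coeff-*ₚ : ∀ a p q i → coeff ((a ∷ p) *ₚ q) i ≡ a * coeff q i + coeff (shift (p *ₚ q)) i
coeff-*ₚ a p q i =
  trans (coeff-+ₚ (scale a q) (shift (p *ₚ q)) i) (cong (_+ coeff (shift (p *ₚ q)) i) (coeff-scale a q i))

shift-cong : ∀ p q → p ≈ₚ q → shift p ≈ₚ shift q
shift-cong p q e zero    = refl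
shift-cong p q e (suc i) = e i

+ₚ-cong : ∀ p p′ q q′ → p ≈ₚ p′ → q ≈ₚ q′ → (p +ₚ q) ≈ₚ (p′ +ₚ q′)
+ₚ-cong p p′ q q′ e f i =
  trans (coeff-+ₚ p q i) (trans (cong₂ _+_ (e i) (f i)) (sym (coeff-+ₚ p′ q′ i)))

*ₚ-zeroʳ : ∀ p → (p *ₚ []) ≈ₚ []
*ₚ-zeroʳ []      i       = refl
*ₚ-zeroʳ (a ∷ p) zero    = refl
*ₚ-zeroʳ (a ∷ p) (suc i) = *ₚ-zeroʳ p i

*ₚ-zeroˡ : ∀ p q → p ≈ₚ [] → (p *ₚ q) ≈ₚ []
*ₚ-zeroˡ []      q z i = refl
*ₚ-zeroˡ (a ∷ p) q z i = begin
  coeff ((a ∷ p) *ₚ q) i                  ≡⟨ coeff-*ₚ a p q i ⟩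
  a * coeff q i + coeff (shift (p *ₚ q)) i ≡⟨ cong₂ _+_ (cong (_* coeff q i) (z zero)) (shift-zero i) ⟩
  0ℚ * coeff q i + 0ℚ                     ≡⟨ trans (ℚP.+-identityʳ _) (ℚP.*-zeroˡ (coeff q i)) ⟩
  0ℚ                                      ∎
  where
  open ≡-Reasoning
  shift-zero : ∀ i → coeff (shift (p *ₚ q)) i ≡ 0ℚ
  shift-zero zero    = refl
  shift-zero (suc j) = *ₚ-zeroˡ p q (λ k → z (suc k)) j

*ₚ-congˡ : ∀ p p′ q → p ≈ₚ p′ → (p *ₚ q) ≈ₚ (p′ *ₚ q)
*ₚ-congˡ []      p′        q e i = sym (*ₚ-zeroˡ p′ q (λ j → sym (e j)) i)
*ₚ-congˡ (a ∷ p) []        q e i = *ₚ-zeroˡ (a ∷ p) q e i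
*ₚ-congˡ (a ∷ p) (a′ ∷ p′) q e i =
  trans (coeff-*ₚ a p q i)
    (trans (cong₂ _+_ (cong (_* coeff q i) (e zero)) (shift-cong (p *ₚ q) (p′ *ₚ q) (*ₚ-congˡ p p′ q (λ j → e (suc j))) i))
      (sym (coeff-*ₚ a′ p′ q i)))

*ₚ-consʳ : ∀ p b q → (p *ₚ (b ∷ q)) ≈ₚ (scale b p +ₚ shift (p *ₚ q))
*ₚ-consʳ []      b q zero    = refl
*ₚ-consʳ []      b q (suc i) = refl
*ₚ-consʳ (a ∷ p) b q zero    =
  trans (coeff-*ₚ a p (b ∷ q) zero)
    (trans (solve 2 (λ a b → a :* b :+ con 0ℚ := b :* a :+ con 0ℚ) refl a b)
      (sym (coeff-+ₚ (scale b (a ∷ p)) (shift ((a ∷ p) *ₚ q)) zero)))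
*ₚ-consʳ (a ∷ p) b q (suc i) = begin
  coeff ((a ∷ p) *ₚ (b ∷ q)) (suc i)
    ≡⟨ coeff-*ₚ a p (b ∷ q) (suc i) ⟩
  a * qᵢ + coeff (p *ₚ (b ∷ q)) i
    ≡⟨ cong ((a * qᵢ) +_) (trans (*ₚ-consʳ p b q i) (coeff-+ₚ (scale b p) (shift (p *ₚ q)) i)) ⟩
  a * qᵢ + (coeff (scale b p) i + coeff (shift (p *ₚ q)) i)
    ≡⟨ cong (λ z → a * qᵢ + (z + coeff (shift (p *ₚ q)) i)) (coeff-scale b p i) ⟩
  a * qᵢ + (b * coeff p i + coeff (shift (p *ₚ q)) i)
    ≡⟨ solve 4 (λ x y z w → x :+ (z :+ w) := z :+ (x :+ w)) refl (a * qᵢ) (coeff q i) (b * coeff p i) _ ⟩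
  b * coeff p i + (a * qᵢ + coeff (shift (p *ₚ q)) i)
    ≡⟨ cong₂ _+_ (sym (coeff-scale b p i)) (sym (coeff-*ₚ a p q i)) ⟩
  coeff (scale b p) i + coeff ((a ∷ p) *ₚ q) i
    ≡⟨ sym (coeff-+ₚ (scale b (a ∷ p)) (shift ((a ∷ p) *ₚ q)) (suc i)) ⟩
  coeff (scale b (a ∷ p) +ₚ shift ((a ∷ p) *ₚ q)) (suc i) ∎
  where
  open ≡-Reasoning
  qᵢ = coeff q i

*ₚ-comm : ∀ p q → (p *ₚ q) ≈ₚ (q *ₚ p)
*ₚ-comm []      q i = sym (*ₚ-zeroʳ q i)
*ₚ-comm (a ∷ p) q i =
  sym (trans (*ₚ-consʳ q a p i) (+ₚ-cong (scale a q) (scale a q) (shift (q *ₚ p)) (shift (p *ₚ q)) (λ _ → refl) (shift-cong (q *ₚ p) (p *ₚ q) (*ₚ-comm q p)) i))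

*ₚ-congʳ : ∀ p q q′ → q ≈ₚ q′ → (p *ₚ q) ≈ₚ (p *ₚ q′)
*ₚ-congʳ p q q′ e i = trans (*ₚ-comm p q i) (trans (*ₚ-congˡ q q′ p e i) (*ₚ-comm q′ p i))

*ₚ-distribʳ : ∀ p q r → ((p +ₚ q) *ₚ r) ≈ₚ ((p *ₚ r) +ₚ (q *ₚ r))
*ₚ-distribʳ []      q       r i = refl
*ₚ-distribʳ (a ∷ p) []      r i = sym (trans (coeff-+ₚ ((a ∷ p) *ₚ r) [] i) (ℚP.+-identityʳ _))
*ₚ-distribʳ (a ∷ p) (b ∷ q) r i = begin
  coeff (((a + b) ∷ (p +ₚ q)) *ₚ r) i
    ≡⟨ coeff-*ₚ (a + b) (p +ₚ q) r i ⟩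
  (a + b) * rᵢ + coeff (shift ((p +ₚ q) *ₚ r)) i
    ≡⟨ cong (((a + b) * rᵢ) +_) (shift-+ i) ⟩
  (a + b) * rᵢ + (coeff (shift (p *ₚ r)) i + coeff (shift (q *ₚ r)) i)
    ≡⟨ solve 5 (λ a b r x y → (a :+ b) :* r :+ (x :+ y) := (a :* r :+ x) :+ (b :* r :+ y)) refl a b rᵢ _ _ ⟩
  (a * rᵢ + coeff (shift (p *ₚ r)) i) + (b * rᵢ + coeff (shift (q *ₚ r)) i)
    ≡⟨ sym (cong₂ _+_ (coeff-*ₚ a p r i) (coeff-*ₚ b q r i)) ⟩
  coeff ((a ∷ p) *ₚ r) i + coeff ((b ∷ q) *ₚ r) i
    ≡⟨ sym (coeff-+ₚ ((a ∷ p) *ₚ r) ((b ∷ q) *ₚ r) i) ⟩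
  coeff (((a ∷ p) *ₚ r) +ₚ ((b ∷ q) *ₚ r)) i ∎
  where
  open ≡-Reasoning
  rᵢ = coeff r i
  shift-+ : ∀ i → coeff (shift ((p +ₚ q) *ₚ r)) i ≡ coeff (shift (p *ₚ r)) i + coeff (shift (q *ₚ r)) i
  shift-+ zero    = sym (ℚP.+-identityʳ 0ℚ)
  shift-+ (suc j) = trans (*ₚ-distribʳ p q r j) (coeff-+ₚ (p *ₚ r) (q *ₚ r) j)

scale-*ₚ : ∀ c p q → (scale c p *ₚ q) ≈ₚ scale c (p *ₚ q)
scale-*ₚ c []      q i = refl
scale-*ₚ c (a ∷ p) q i = begin
  coeff ((c * a ∷ scale c p) *ₚ q) i
    ≡⟨ coeff-*ₚ (c * a) (scale c p) q i ⟩
  c * a * coeff q i + coeff (shift (scale c p *ₚ q)) i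
    ≡⟨ cong ((c * a * coeff q i) +_) (shift-scale i) ⟩
  c * a * coeff q i + c * coeff (shift (p *ₚ q)) i
    ≡⟨ solve 4 (λ c a x y → c :* a :* x :+ c :* y := c :* (a :* x :+ y)) refl c a (coeff q i) _ ⟩
  c * (a * coeff q i + coeff (shift (p *ₚ q)) i)
    ≡⟨ cong (c *_) (sym (coeff-*ₚ a p q i)) ⟩
  c * coeff ((a ∷ p) *ₚ q) i
    ≡⟨ sym (coeff-scale c ((a ∷ p) *ₚ q) i) ⟩
  coeff (scale c ((a ∷ p) *ₚ q)) i ∎
  where
  open ≡-Reasoning
  shift-scale : ∀ i → coeff (shift (scale c p *ₚ q)) i ≡ c * coeff (shift (p *ₚ q)) i
  shift-scale zero    = sym (ℚP.*-zeroʳ c)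
  shift-scale (suc j) = trans (scale-*ₚ c p q j) (coeff-scale c (p *ₚ q) j)

shift-*ₚ : ∀ p q → (shift p *ₚ q) ≈ₚ shift (p *ₚ q)
shift-*ₚ p q i =
  trans (coeff-*ₚ 0ℚ p q i)
    (trans (cong (_+ coeff (shift (p *ₚ q)) i) (ℚP.*-zeroˡ (coeff q i))) (ℚP.+-identityˡ _))

*ₚ-assoc : ∀ p q r → ((p *ₚ q) *ₚ r) ≈ₚ (p *ₚ (q *ₚ r))
*ₚ-assoc []      q r i = refl
*ₚ-assoc (a ∷ p) q r i =
  trans (*ₚ-distribʳ (scale a q) (shift (p *ₚ q)) r i)
    (+ₚ-cong (scale a q *ₚ r) (scale a (q *ₚ r)) (shift (p *ₚ q) *ₚ r) (shift (p *ₚ (q *ₚ r)))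
       (scale-*ₚ a q r) (λ j → trans (shift-*ₚ (p *ₚ q) r j) (shift-cong ((p *ₚ q) *ₚ r) (p *ₚ (q *ₚ r)) (*ₚ-assoc p q r) j)) i)

eval : Poly → ℚ → ℚ
eval []       t = 0ℚ
eval (c ∷ cs) t = c + t * eval cs t

eval-zero : ∀ p t → p ≈ₚ [] → eval p t ≡ 0ℚ
eval-zero []      t z = refl
eval-zero (a ∷ p) t z rewrite z zero | eval-zero p t (λ i → z (suc i)) =
  solve 1 (λ t → con 0ℚ :+ t :* con 0ℚ := con 0ℚ) refl t

eval-cong : ∀ p q t → p ≈ₚ q → eval p t ≡ eval q t
eval-cong []      q       t e = sym (eval-zero q t (λ i → sym (e i)))
eval-cong (a ∷ p) []      t e = eval-zero (a ∷ p) t e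
eval-cong (a ∷ p) (b ∷ q) t e = cong₂ (λ x y → x + t * y) (e zero) (eval-cong p q t (λ i → e (suc i)))

eval-+ₚ : ∀ p q t → eval (p +ₚ q) t ≡ eval p t + eval q t
eval-+ₚ []      q       t = sym (ℚP.+-identityˡ _)
eval-+ₚ (a ∷ p) []      t = sym (ℚP.+-identityʳ _)
eval-+ₚ (a ∷ p) (b ∷ q) t rewrite eval-+ₚ p q t =
  solve 5 (λ a b t x y → (a :+ b) :+ t :* (x :+ y) := (a :+ t :* x) :+ (b :+ t :* y)) refl a b t (eval p t) (eval q t)

eval-scale : ∀ c p t → eval (scale c p) t ≡ c * eval p t
eval-scale c []      t = sym (ℚP.*-zeroʳ c)
eval-scale c (a ∷ p) t rewrite eval-scale c p t =
  solve 4 (λ c a t x → c :* a :+ t :* (c :* x) := c :* (a :+ t :* x)) refl c a t (eval p t)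

eval-*ₚ : ∀ p q t → eval (p *ₚ q) t ≡ eval p t * eval q t
eval-*ₚ []      q t = sym (ℚP.*-zeroˡ (eval q t))
eval-*ₚ (a ∷ p) q t rewrite eval-+ₚ (scale a q) (shift (p *ₚ q)) t | eval-scale a q t | eval-*ₚ p q t =
  solve 4 (λ a t x z → a :* z :+ (con 0ℚ :+ t :* (x :* z)) := (a :+ t :* x) :* z) refl a t (eval p t) (eval q t)

eval-linear-root : ∀ r → eval (linear r) r ≡ 0ℚ
eval-linear-root r = solve 1 (λ r → :- r :+ r :* (con 1ℚ :+ r :* con 0ℚ) := con 0ℚ) refl r

eval-prod-root : ∀ rs r → r ∈ rs → eval (prodₚ (map linear rs)) r ≡ 0ℚ
eval-prod-root (r′ ∷ rs) r (here refl) =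
  trans (eval-*ₚ (linear r) (prodₚ (map linear rs)) r)
    (trans (cong (_* eval (prodₚ (map linear rs)) r) (eval-linear-root r)) (ℚP.*-zeroˡ (eval (prodₚ (map linear rs)) r)))
eval-prod-root (r′ ∷ rs) r (there r∈rs) =
  trans (eval-*ₚ (linear r′) (prodₚ (map linear rs)) r)
    (trans (cong (eval (linear r′) r *_) (eval-prod-root rs r r∈rs)) (ℚP.*-zeroʳ (eval (linear r′) r)))

coeff-linear-*ₚ-zero : ∀ a s → coeff (linear a *ₚ s) zero ≡ - a * coeff s zero
coeff-linear-*ₚ-zero a s = trans (coeff-*ₚ (- a) (1ℚ ∷ []) s zero) (ℚP.+-identityʳ _)

coeff-linear-*ₚ-suc : ∀ a s i → coeff (linear a *ₚ s) (suc i) ≡ coeff s i + - a * coeff s (suc i)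
coeff-linear-*ₚ-suc a s i = begin
  coeff (linear a *ₚ s) (suc i)                     ≡⟨ coeff-*ₚ (- a) (1ℚ ∷ []) s (suc i) ⟩
  - a * coeff s (suc i) + coeff ((1ℚ ∷ []) *ₚ s) i  ≡⟨ cong ((- a * coeff s (suc i)) +_) (coeff-*ₚ 1ℚ [] s i) ⟩
  - a * coeff s (suc i) + (1ℚ * coeff s i + coeff (shift []) i)
    ≡⟨ cong (λ z → - a * coeff s (suc i) + (1ℚ * coeff s i + z)) (coeff-shift-[] i) ⟩
  - a * coeff s (suc i) + (1ℚ * coeff s i + 0ℚ)
    ≡⟨ solve 3 (λ a x y → :- a :* y :+ (con 1ℚ :* x :+ con 0ℚ) := x :+ :- a :* y) refl a (coeff s i) (coeff s (suc i)) ⟩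
  coeff s i + - a * coeff s (suc i)                 ∎
  where
  open ≡-Reasoning
  coeff-shift-[] : ∀ i → coeff (shift []) i ≡ 0ℚ
  coeff-shift-[] zero    = refl
  coeff-shift-[] (suc i) = refl

quotient : ℚ → Poly → Poly
quotient a []       = []
quotient a (c ∷ cs) = eval cs a ∷ quotient a cs

division : ∀ a p → p ≈ₚ ((linear a *ₚ quotient a p) +ₚ (eval p a ∷ []))
division a [] i = sym (begin
  coeff ((linear a *ₚ []) +ₚ (0ℚ ∷ [])) i      ≡⟨ coeff-+ₚ (linear a *ₚ []) (0ℚ ∷ []) i ⟩
  coeff (linear a *ₚ []) i + coeff (0ℚ ∷ []) i ≡⟨ cong₂ _+_ (*ₚ-zeroʳ (linear a) i) (coeff-zero i) ⟩
  0ℚ + 0ℚ                                      ≡⟨ ℚP.+-identityˡ 0ℚ ⟩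
  0ℚ                                           ∎)
  where
  open ≡-Reasoning
  coeff-zero : ∀ i → coeff (0ℚ ∷ []) i ≡ 0ℚ
  coeff-zero zero    = refl
  coeff-zero (suc i) = refl
division a (c ∷ cs) zero = sym (begin
  coeff ((linear a *ₚ (r ∷ s)) +ₚ ((c + a * r) ∷ [])) zero ≡⟨ coeff-+ₚ (linear a *ₚ (r ∷ s)) ((c + a * r) ∷ []) zero ⟩
  coeff (linear a *ₚ (r ∷ s)) zero + (c + a * r)           ≡⟨ cong (_+ (c + a * r)) (coeff-linear-*ₚ-zero a (r ∷ s)) ⟩
  - a * r + (c + a * r)                                    ≡⟨ solve 3 (λ a r c → :- a :* r :+ (c :+ a :* r) := c) refl a r c ⟩
  c                                                        ∎)
  where
  open ≡-Reasoning
  r = eval cs a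
  s = quotient a cs
division a (c ∷ cs) (suc i) = begin
  coeff cs i                                                    ≡⟨ division a cs i ⟩
  coeff ((linear a *ₚ s) +ₚ (r ∷ [])) i                          ≡⟨ coeff-+ₚ (linear a *ₚ s) (r ∷ []) i ⟩
  coeff (linear a *ₚ s) i + coeff (r ∷ []) i                     ≡⟨ step i ⟩
  coeff (linear a *ₚ (r ∷ s)) (suc i) + coeff ((c + a * r) ∷ []) (suc i)
    ≡⟨ sym (coeff-+ₚ (linear a *ₚ (r ∷ s)) ((c + a * r) ∷ []) (suc i)) ⟩
  coeff ((linear a *ₚ (r ∷ s)) +ₚ ((c + a * r) ∷ [])) (suc i)    ∎
  where
  open ≡-Reasoning
  r = eval cs a
  s = quotient a cs
  step : ∀ i → coeff (linear a *ₚ s) i + coeff (r ∷ []) i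
             ≡ coeff (linear a *ₚ (r ∷ s)) (suc i) + coeff ((c + a * r) ∷ []) (suc i)
  step zero    = begin
    coeff (linear a *ₚ s) zero + r        ≡⟨ cong (_+ r) (coeff-linear-*ₚ-zero a s) ⟩
    - a * coeff s zero + r                ≡⟨ solve 3 (λ a s r → :- a :* s :+ r := (r :+ :- a :* s) :+ con 0ℚ) refl a (coeff s zero) r ⟩
    (r + - a * coeff s zero) + 0ℚ          ≡⟨ cong (_+ 0ℚ) (sym (coeff-linear-*ₚ-suc a (r ∷ s) zero)) ⟩
    coeff (linear a *ₚ (r ∷ s)) 1 + 0ℚ    ∎
  step (suc k) = cong (_+ 0ℚ) (trans (coeff-linear-*ₚ-suc a s k) (sym (coeff-linear-*ₚ-suc a (r ∷ s) (suc k))))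

factor-theorem : ∀ a p → eval p a ≡ 0ℚ → p ≈ₚ (linear a *ₚ quotient a p)
factor-theorem a p root i = begin
  coeff p i                                                 ≡⟨ division a p i ⟩
  coeff ((linear a *ₚ quotient a p) +ₚ (eval p a ∷ [])) i   ≡⟨ coeff-+ₚ (linear a *ₚ quotient a p) (eval p a ∷ []) i ⟩
  coeff (linear a *ₚ quotient a p) i + coeff (eval p a ∷ []) i ≡⟨ cong (coeff (linear a *ₚ quotient a p) i +_) (no-remainder i) ⟩
  coeff (linear a *ₚ quotient a p) i + 0ℚ                   ≡⟨ ℚP.+-identityʳ _ ⟩
  coeff (linear a *ₚ quotient a p) i                        ∎
  where
  open ≡-Reasoning
  no-remainder : ∀ i → coeff (eval p a ∷ []) i ≡ 0ℚ
  no-remainder zero    = root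
  no-remainder (suc i) = refl

coeff-beyond-length : ∀ p i → length p ≤ i → coeff p i ≡ 0ℚ
coeff-beyond-length []      i       le        = refl
coeff-beyond-length (a ∷ p) (suc i) (s≤s le) = coeff-beyond-length p i le

-- x - a is cancellable: compare coefficients downwards from the top.
linear-cancel : ∀ a p q → (linear a *ₚ p) ≈ₚ (linear a *ₚ q) → p ≈ₚ q
linear-cancel a p q e i = downwards L i (ℕP.m≤n+m L i)
  where
  L = length p ℕ.⊔ length q
  step : ∀ i → coeff p (suc i) ≡ coeff q (suc i) → coeff p i ≡ coeff q i
  step i eq = begin
    coeff p i                                                  ≡⟨ solve 3 (λ a x y → x := (x :+ :- a :* y) :+ a :* y) refl a (coeff p i) (coeff p (suc i)) ⟩
    (coeff p i + - a * coeff p (suc i)) + a * coeff p (suc i)  ≡⟨ cong₂ _+_ same-next (cong (a *_) eq) ⟩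
    (coeff q i + - a * coeff q (suc i)) + a * coeff q (suc i)  ≡⟨ solve 3 (λ a x y → (x :+ :- a :* y) :+ a :* y := x) refl a (coeff q i) (coeff q (suc i)) ⟩
    coeff q i                                                  ∎
    where
    open ≡-Reasoning
    same-next : coeff p i + - a * coeff p (suc i) ≡ coeff q i + - a * coeff q (suc i)
    same-next = trans (sym (coeff-linear-*ₚ-suc a p i)) (trans (e (suc i)) (coeff-linear-*ₚ-suc a q i))
  -- the claim at i, by induction on the distance k from i to beyond both lengths
  downwards : ∀ k i → L ≤ i ℕ.+ k → coeff p i ≡ coeff q i
  downwards zero    i le = trans (coeff-beyond-length p i (ℕP.≤-trans (ℕP.m≤m⊔n _ _) le′))
                                 (sym (coeff-beyond-length q i (ℕP.≤-trans (ℕP.m≤n⊔m _ _) le′)))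
    where le′ = subst (L ≤_) (ℕP.+-identityʳ i) le
  downwards (suc k) i le = step i (downwards k (suc i) (subst (L ≤_) (ℕP.+-suc i k) le))

record Leading (p : Poly) (n : ℕ) (v : ℚ) : Set where
  constructor leading
  field
    top     : coeff p n ≡ v
    nonzero : ¬ v ≡ 0ℚ
    beyond  : ∀ m → n < m → coeff p m ≡ 0ℚ

zero-or-leading : ∀ p → (p ≈ₚ []) ⊎ (Σ ℕ λ n → Σ ℚ λ v → Leading p n v)
zero-or-leading []      = inj₁ (λ i → refl)
zero-or-leading (a ∷ p) with zero-or-leading p
... | inj₂ (n , v , leading c v≢0 above) = inj₂ (suc n , v , leading c v≢0 λ { (suc m) (s≤s lt) → above m lt })
... | inj₁ p≈0 with a ℚP.≟ 0ℚ
...   | yes a≡0 = inj₁ (λ { zero → a≡0 ; (suc i) → p≈0 i })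
...   | no  a≢0 = inj₂ (zero , a , leading refl a≢0 λ { (suc m) _ → p≈0 m })

leading-unique : ∀ {p n m u v} → Leading p n u → Leading p m v → n ≡ m × u ≡ v
leading-unique {n = n} {m} (leading c₁ u≢0 above₁) (leading c₂ v≢0 above₂) with ℕP.<-cmp n m
... | tri< n<m _ _    = ⊥-elim (v≢0 (trans (sym c₂) (above₁ m n<m)))
... | tri> _ _ m<n    = ⊥-elim (u≢0 (trans (sym c₁) (above₂ n m<n)))
... | tri≈ _ refl _   = refl , trans (sym c₁) c₂

leading-cong : ∀ {p q n v} → p ≈ₚ q → Leading p n v → Leading q n v
leading-cong {n = n} e (leading c v≢0 above) = leading (trans (sym (e n)) c) v≢0 λ m lt → trans (sym (e m)) (above m lt)

*-nonzero : ∀ u v → ¬ u ≡ 0ℚ → ¬ v ≡ 0ℚ → ¬ (u * v) ≡ 0ℚ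
*-nonzero u v u≢0 v≢0 uv≡0 = v≢0 (begin
  v                    ≡⟨ sym (ℚP.*-identityˡ v) ⟩
  1ℚ * v               ≡⟨ cong (_* v) (sym (ℚP.*-inverseˡ u)) ⟩
  ((1/ u) * u) * v     ≡⟨ ℚP.*-assoc (1/ u) u v ⟩
  (1/ u) * (u * v)     ≡⟨ cong ((1/ u) *_) uv≡0 ⟩
  (1/ u) * 0ℚ          ≡⟨ ℚP.*-zeroʳ (1/ u) ⟩
  0ℚ                   ∎)
  where
  open ≡-Reasoning
  instance u-nonZero = ℚ.≢-nonZero u≢0

leading-*ₚ : ∀ p q n d u v → Leading p n u → Leading q d v → Leading (p *ₚ q) (n ℕ.+ d) (u * v)
leading-*ₚ []       q n       d u v (leading c u≢0 _) _ = ⊥-elim (u≢0 (sym c))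
leading-*ₚ (a ∷ p′) q zero    d u v (leading c u≢0 above) (leading cq v≢0 aboveq) =
  leading (trans (constant-times d) (cong₂ _*_ c cq)) (*-nonzero u v u≢0 v≢0)
  λ m lt → trans (constant-times m) (trans (cong (a *_) (aboveq m lt)) (ℚP.*-zeroʳ a))
  where
  shifted-zero : ∀ m → coeff (shift (p′ *ₚ q)) m ≡ 0ℚ
  shifted-zero zero    = refl
  shifted-zero (suc j) = *ₚ-zeroˡ p′ q (λ j → above (suc j) (s≤s z≤n)) j
  constant-times : ∀ m → coeff ((a ∷ p′) *ₚ q) m ≡ a * coeff q m
  constant-times m = trans (coeff-*ₚ a p′ q m) (trans (cong (a * coeff q m +_) (shifted-zero m)) (ℚP.+-identityʳ _))
leading-*ₚ (a ∷ p′) q (suc n) d u v (leading c u≢0 above) lq@(leading cq v≢0 aboveq) =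
  leading top (Leading.nonzero ih) beyond
  where
  ih = leading-*ₚ p′ q n d u v (leading c u≢0 λ m lt → above (suc m) (s≤s lt)) lq
  a*q-vanishes : ∀ m → d < m → a * coeff q m ≡ 0ℚ
  a*q-vanishes m lt = trans (cong (a *_) (aboveq m lt)) (ℚP.*-zeroʳ a)
  top : coeff ((a ∷ p′) *ₚ q) (suc (n ℕ.+ d)) ≡ u * v
  top = trans (coeff-*ₚ a p′ q (suc (n ℕ.+ d)))
          (trans (cong₂ _+_ (a*q-vanishes _ (s≤s (ℕP.m≤n+m d n))) (Leading.top ih)) (ℚP.+-identityˡ _))
  beyond : ∀ m → suc (n ℕ.+ d) < m → coeff ((a ∷ p′) *ₚ q) m ≡ 0ℚ
  beyond (suc m) (s≤s lt) =
    trans (coeff-*ₚ a p′ q (suc m))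
      (trans (cong₂ _+_ (a*q-vanishes _ (s≤s (ℕP.≤-trans (ℕP.m≤n+m d n) (ℕP.<⇒≤ lt)))) (Leading.beyond ih m lt))
        (ℚP.+-identityʳ 0ℚ))

monic-leading : ∀ p → (m : Monic p) → Leading p (proj₁ m) 1ℚ
monic-leading p (n , c , above) = leading c ℚP.1≢0 above

linear-leading : ∀ a → Leading (linear a) 1 1ℚ
linear-leading a = leading refl ℚP.1≢0 λ { (suc (suc m)) _ → refl ; (suc zero) (s≤s ()) }

monic-divisor-of-one : ∀ P → Monic P → P ∣ₚ (1ℚ ∷ []) → P ≈ₚ (1ℚ ∷ [])
monic-divisor-of-one P mon@(n , cn , above) (R , PR≈1) with zero-or-leading R
... | inj₁ R≈0 = ⊥-elim (ℚP.1≢0 (trans (sym (PR≈1 zero)) (trans (*ₚ-congʳ P R [] R≈0 zero) (*ₚ-zeroʳ P zero))))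
... | inj₂ (d , v , lR) = P≈1
  where
  one-leading : Leading (1ℚ ∷ []) 0 1ℚ
  one-leading = leading refl ℚP.1≢0 λ { (suc m) _ → refl }
  n≡0 : n ≡ 0
  n≡0 = ℕP.m+n≡0⇒m≡0 n (proj₁ (leading-unique
          (leading-cong PR≈1 (leading-*ₚ P R n d 1ℚ v (monic-leading P mon) lR)) one-leading))
  P≈1 : P ≈ₚ (1ℚ ∷ [])
  P≈1 zero    = subst (λ k → coeff P k ≡ 1ℚ) n≡0 cn
  P≈1 (suc i) = above (suc i) (subst (_< suc i) (sym n≡0) (s≤s z≤n))

monic-cofactor : ∀ a P S → Monic P → P ≈ₚ (linear a *ₚ S) → Monic S
monic-cofactor a P S mon@(n , cn , _) P≈aS with zero-or-leading S
... | inj₁ S≈0 = ⊥-elim (ℚP.1≢0 (trans (sym cn)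
        (trans (P≈aS n) (trans (*ₚ-congʳ (linear a) S [] S≈0 n) (*ₚ-zeroʳ (linear a) n)))))
... | inj₂ (d , v , lS) = d , trans (Leading.top lS) v≡1 , Leading.beyond lS
  where
  v≡1 : v ≡ 1ℚ
  v≡1 = trans (sym (ℚP.*-identityˡ v)) (proj₂ (leading-unique
          (leading-cong (λ i → sym (P≈aS i)) (leading-*ₚ (linear a) S 1 d 1ℚ v (linear-leading a) lS))
          (monic-leading P mon)))

-- Induction on the list: if P(r) = 0 then P = (x - r) S and S divides the
-- rest; otherwise the cofactor vanishes at r and loses the factor x - r.
monic-divisor-splits : ∀ rs P → Monic P → P ∣ₚ prodₚ (map linear rs) → SplitsOverℚ P
monic-divisor-splits [] P mon P∣1 = [] , monic-divisor-of-one P mon P∣1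
monic-divisor-splits (a ∷ rs) P mon (R , PR≈aM) with eval P a ℚP.≟ 0ℚ
... | yes P[a]≡0 = a ∷ proj₁ splitS , P≈
  where
  M = prodₚ (map linear rs)
  S = quotient a P
  P≈aS : P ≈ₚ (linear a *ₚ S)
  P≈aS = factor-theorem a P P[a]≡0
  SR≈M : (S *ₚ R) ≈ₚ M
  SR≈M = linear-cancel a (S *ₚ R) M (λ i →
    trans (sym (*ₚ-assoc (linear a) S R i)) (trans (*ₚ-congˡ (linear a *ₚ S) P R (λ j → sym (P≈aS j)) i) (PR≈aM i)))
  splitS = monic-divisor-splits rs S (monic-cofactor a P S mon P≈aS) (R , SR≈M)
  P≈ : P ≈ₚ prodₚ (map linear (a ∷ proj₁ splitS))
  P≈ i = trans (P≈aS i) (*ₚ-congʳ (linear a) S (prodₚ (map linear (proj₁ splitS))) (proj₂ splitS) i)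
... | no P[a]≢0 = monic-divisor-splits rs P mon (R′ , PR′≈M)
  where
  M = prodₚ (map linear rs)
  R′ = quotient a R
  R[a]≡0 : eval R a ≡ 0ℚ
  R[a]≡0 with eval R a ℚP.≟ 0ℚ
  ... | yes R[a]≡0 = R[a]≡0
  ... | no  R[a]≢0 = ⊥-elim (*-nonzero _ _ P[a]≢0 R[a]≢0 (begin
    eval P a * eval R a           ≡⟨ sym (eval-*ₚ P R a) ⟩
    eval (P *ₚ R) a               ≡⟨ eval-cong (P *ₚ R) (linear a *ₚ M) a PR≈aM ⟩
    eval (linear a *ₚ M) a        ≡⟨ eval-*ₚ (linear a) M a ⟩
    eval (linear a) a * eval M a  ≡⟨ cong (_* eval M a) (eval-linear-root a) ⟩
    0ℚ * eval M a                 ≡⟨ ℚP.*-zeroˡ (eval M a) ⟩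
    0ℚ                            ∎))
    where open ≡-Reasoning
  R≈aR′ : R ≈ₚ (linear a *ₚ R′)
  R≈aR′ = factor-theorem a R R[a]≡0
  PR′≈M : (P *ₚ R′) ≈ₚ M
  PR′≈M = linear-cancel a (P *ₚ R′) M λ i → begin
    coeff (linear a *ₚ (P *ₚ R′)) i    ≡⟨ sym (*ₚ-assoc (linear a) P R′ i) ⟩
    coeff ((linear a *ₚ P) *ₚ R′) i    ≡⟨ *ₚ-congˡ (linear a *ₚ P) (P *ₚ linear a) R′ (*ₚ-comm (linear a) P) i ⟩
    coeff ((P *ₚ linear a) *ₚ R′) i    ≡⟨ *ₚ-assoc P (linear a) R′ i ⟩
    coeff (P *ₚ (linear a *ₚ R′)) i    ≡⟨ *ₚ-congʳ P (linear a *ₚ R′) R (λ j → sym (R≈aR′ j)) i ⟩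
    coeff (P *ₚ R) i                   ≡⟨ PR≈aM i ⟩
    coeff (linear a *ₚ M) i            ∎
    where open ≡-Reasoning

bit : Bool → ℕ
bit true  = 1
bit false = 0

countTrue-suc : ∀ {k} (s : Fin (suc k) → Bool) → countTrue s ≡ bit (s zero) ℕ.+ countTrue (λ i → s (suc i))
countTrue-suc s with s zero
... | true  = refl
... | false = refl

countTrue-ext : ∀ {k} (s t : Fin k → Bool) → (∀ i → s i ≡ t i) → countTrue s ≡ countTrue t
countTrue-ext {zero}  s t e = refl
countTrue-ext {suc k} s t e =
  trans (countTrue-suc s)
    (trans (cong₂ ℕ._+_ (cong bit (e zero)) (countTrue-ext (λ i → s (suc i)) (λ i → t (suc i)) (λ i → e (suc i))))
      (sym (countTrue-suc t)))

countTrue-≤ : ∀ {k} (s : Fin k → Bool) → countTrue s ≤ k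
countTrue-≤ {zero}  s = z≤n
countTrue-≤ {suc k} s rewrite countTrue-suc s with s zero
... | true  = s≤s (countTrue-≤ (λ i → s (suc i)))
... | false = ℕP.m≤n⇒m≤1+n (countTrue-≤ (λ i → s (suc i)))

countTrue-allFalse : ∀ {k} (s : Fin k → Bool) → (∀ i → s i ≡ false) → countTrue s ≡ 0
countTrue-allFalse {zero}  s f = refl
countTrue-allFalse {suc k} s f rewrite countTrue-suc s | f zero = countTrue-allFalse (λ i → s (suc i)) (λ i → f (suc i))

countTrue-allTrue : ∀ k → countTrue {k} (λ _ → true) ≡ k
countTrue-allTrue zero    = refl
countTrue-allTrue (suc k) = cong suc (countTrue-allTrue k)

countTrue-pos : ∀ {k} (s : Fin k → Bool) i → s i ≡ true → 1 ≤ countTrue s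
countTrue-pos {suc k} s zero    e rewrite countTrue-suc s | e = s≤s z≤n
countTrue-pos {suc k} s (suc i) e rewrite countTrue-suc s =
  ℕP.≤-trans (countTrue-pos (λ i → s (suc i)) i e) (ℕP.m≤n+m _ (bit (s zero)))

countTrue-split : ∀ {k} (s t : Fin k → Bool) →
                  countTrue s ≡ countTrue (λ i → s i ∧ t i) ℕ.+ countTrue (λ i → s i ∧ not (t i))
countTrue-split {zero}  s t = refl
countTrue-split {suc k} s t = begin
  countTrue s
    ≡⟨ countTrue-suc s ⟩
  bit (s zero) ℕ.+ countTrue (λ i → s (suc i))
    ≡⟨ cong₂ ℕ._+_ (bit-split (s zero) (t zero)) (countTrue-split (λ i → s (suc i)) (λ i → t (suc i))) ⟩
  (bit (s zero ∧ t zero) ℕ.+ bit (s zero ∧ not (t zero))) ℕ.+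
    (countTrue (λ i → s (suc i) ∧ t (suc i)) ℕ.+ countTrue (λ i → s (suc i) ∧ not (t (suc i))))
    ≡⟨ +-interchange (bit (s zero ∧ t zero)) _ _ _ ⟩
  (bit (s zero ∧ t zero) ℕ.+ countTrue (λ i → s (suc i) ∧ t (suc i))) ℕ.+
    (bit (s zero ∧ not (t zero)) ℕ.+ countTrue (λ i → s (suc i) ∧ not (t (suc i))))
    ≡⟨ sym (cong₂ ℕ._+_ (countTrue-suc (λ i → s i ∧ t i)) (countTrue-suc (λ i → s i ∧ not (t i)))) ⟩
  countTrue (λ i → s i ∧ t i) ℕ.+ countTrue (λ i → s i ∧ not (t i)) ∎
  where
  open ≡-Reasoning
  bit-split : ∀ a b → bit a ≡ bit (a ∧ b) ℕ.+ bit (a ∧ not b)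
  bit-split true  true  = refl
  bit-split true  false = refl
  bit-split false b     = refl

countTrue-↑ : ∀ m {k} (t : Fin (m ℕ.+ k) → Bool) →
              countTrue t ≡ countTrue (λ i → t (i ↑ˡ k)) ℕ.+ countTrue (λ i → t (m ↑ʳ i))
countTrue-↑ zero    t = refl
countTrue-↑ (suc m) {k} t =
  trans (countTrue-suc t)
    (trans (cong (bit (t zero) ℕ.+_) (countTrue-↑ m (λ i → t (suc i))))
      (trans (sym (ℕP.+-assoc (bit (t zero)) _ _))
        (cong (ℕ._+ countTrue (λ i → t (suc m ↑ʳ i))) (sym (countTrue-suc (λ i → t (i ↑ˡ k)))))))

sumFin : ∀ n → (Fin n → ℕ) → ℕ
sumFin zero    f = 0
sumFin (suc n) f = f zero ℕ.+ sumFin n (λ i → f (suc i))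

sumFin-ext : ∀ n (f g : Fin n → ℕ) → (∀ i → f i ≡ g i) → sumFin n f ≡ sumFin n g
sumFin-ext zero    f g e = refl
sumFin-ext (suc n) f g e = cong₂ ℕ._+_ (e zero) (sumFin-ext n _ _ (λ i → e (suc i)))

sumFin-if : ∀ n (s : Fin n → Bool) c → sumFin n (λ x → if s x then c else 0) ≡ countTrue s ℕ.* c
sumFin-if zero    s c = refl
sumFin-if (suc n) s c rewrite countTrue-suc s | sumFin-if n (λ i → s (suc i)) c with s zero
... | true  = refl
... | false = refl

countTrue-combine : ∀ n m (u : Fin (n ℕ.* m) → Bool) →
                    countTrue u ≡ sumFin n (λ x → countTrue (λ y → u (combine x y)))
countTrue-combine zero    m u = refl
countTrue-combine (suc n) m u =
  trans (countTrue-↑ m u) (cong (countTrue (λ i → u (i ↑ˡ (n ℕ.* m))) ℕ.+_) (countTrue-combine n m (λ i → u (m ↑ʳ i))))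

countTrue-product : ∀ n m (s : Fin n → Bool) (t : Fin m → Bool) (u : Fin (n ℕ.* m) → Bool) →
                    (∀ x y → u (combine x y) ≡ (s x ∧ t y)) → countTrue u ≡ countTrue s ℕ.* countTrue t
countTrue-product n m s t u u≡s∧t =
  trans (countTrue-combine n m u)
    (trans (sumFin-ext n _ _ λ x → trans (countTrue-ext _ _ (u≡s∧t x)) (by-cases (s x)))
      (sumFin-if n s (countTrue t)))
  where
  by-cases : ∀ b → countTrue (λ y → b ∧ t y) ≡ (if b then countTrue t else 0)
  by-cases true  = refl
  by-cases false = countTrue-allFalse {m} _ (λ _ → refl)

_==_ : ∀ {b} → Fin b → Fin b → Bool
x == y = does (x FinP.≟ y)

==-refl : ∀ {b} (x : Fin b) → (x == x) ≡ true
==-refl x = dec-true (x FinP.≟ x) refl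

==-distinct : ∀ {b} (x y : Fin b) → ¬ x ≡ y → (x == y) ≡ false
==-distinct x y = dec-false (x FinP.≟ y)

not-false : ∀ {a} → a ≡ false → not a ≡ true
not-false refl = refl

∧-true : ∀ {a b} → a ≡ true → b ≡ true → (a ∧ b) ≡ true
∧-true refl refl = refl

countTrue-single : ∀ {b} (w : Fin b → Bool) y₀ → w y₀ ≡ true → (∀ y → ¬ y ≡ y₀ → w y ≡ false) → countTrue w ≡ 1
countTrue-single {suc b} w zero     e others rewrite countTrue-suc w | e =
  cong suc (countTrue-allFalse _ (λ i → others (suc i) (λ ())))
countTrue-single {suc b} w (suc y₀) e others rewrite countTrue-suc w | others zero (λ ()) =
  countTrue-single (λ i → w (suc i)) y₀ e (λ y y≢y₀ → others (suc y) (λ eq → y≢y₀ (FinP.suc-injective eq)))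

countTrue-remove : ∀ {b} (t : Fin b → Bool) y₀ → t y₀ ≡ true → countTrue t ≡ suc (countTrue (λ y → t y ∧ not (y == y₀)))
countTrue-remove t y₀ e =
  trans (countTrue-split t (_== y₀))
    (cong (ℕ._+ countTrue (λ y → t y ∧ not (y == y₀)))
      (countTrue-single _ y₀ (∧-true e (==-refl y₀)) λ y y≢y₀ → ∧-false (t y) (==-distinct y y₀ y≢y₀)))
  where
  ∧-false : ∀ a {c} → c ≡ false → (a ∧ c) ≡ false
  ∧-false a refl = BoolP.∧-zeroʳ a

record InjectsInto {a b} (s : Fin a → Bool) (t : Fin b → Bool) (g : Fin a → Fin b) : Set where
  field
    maps-into : ∀ i → s i ≡ true → t (g i) ≡ true
    injective : ∀ i j → s i ≡ true → s j ≡ true → g i ≡ g j → i ≡ j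

countTrue-injection : ∀ {a b} (s : Fin a → Bool) (t : Fin b → Bool) (g : Fin a → Fin b) →
                      InjectsInto s t g → countTrue s ≤ countTrue t
countTrue-injection {zero}  s t g _ = z≤n
countTrue-injection {suc a} s t g inj with s zero in s₀
... | false = countTrue-injection (λ i → s (suc i)) t (λ i → g (suc i)) record
  { maps-into = λ i → maps-into (suc i)
  ; injective = λ i j si sj e → FinP.suc-injective (injective (suc i) (suc j) si sj e) }
  where open InjectsInto inj
... | true  = ℕP.≤-trans (s≤s (countTrue-injection (λ i → s (suc i)) t′ (λ i → g (suc i)) rest))
                (ℕP.≤-reflexive (sym (countTrue-remove t (g zero) (maps-into zero s₀))))
  where
  open InjectsInto inj
  t′ = λ y → t y ∧ not (y == g zero)
  rest : InjectsInto (λ i → s (suc i)) t′ (λ i → g (suc i))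
  rest = record
    { maps-into = λ i si → ∧-true (maps-into (suc i) si)
                             (not-false (==-distinct _ _ (λ e → suc≢zero (injective (suc i) zero si s₀ e))))
    ; injective = λ i j si sj e → FinP.suc-injective (injective (suc i) (suc j) si sj e) }
    where
    suc≢zero : ∀ {i : Fin a} → ¬ suc i ≡ zero
    suc≢zero ()

countTrue-injection-strict : ∀ {a b} (s : Fin a → Bool) (t : Fin b → Bool) (g : Fin a → Fin b) →
                             InjectsInto s t g → (y : Fin b) → t y ≡ true → (∀ i → s i ≡ true → ¬ g i ≡ y) →
                             countTrue s < countTrue t
countTrue-injection-strict s t g inj y ty missed =
  ℕP.≤-trans (s≤s (countTrue-injection s (λ z → t z ∧ not (z == y)) g record
    { maps-into = λ i si → ∧-true (maps-into i si) (not-false (==-distinct _ _ (missed i si)))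
    ; injective = injective }))
    (ℕP.≤-reflexive (sym (countTrue-remove t y ty)))
  where open InjectsInto inj

countTrue-bijection : ∀ {a b} (s : Fin a → Bool) (t : Fin b → Bool) (g : Fin a → Fin b) (h : Fin b → Fin a) →
                      InjectsInto s t g → InjectsInto t s h → countTrue s ≡ countTrue t
countTrue-bijection s t g h g-inj h-inj =
  ℕP.≤-antisym (countTrue-injection s t g g-inj) (countTrue-injection t s h h-inj)

enum : ∀ {n} (s : Fin n → Bool) → Fin (countTrue s) → Fin n
enum {suc n} s j       with s zero
enum {suc n} s zero    | true  = zero
enum {suc n} s (suc j) | true  = suc (enum (λ i → s (suc i)) j)
enum {suc n} s j       | false = suc (enum (λ i → s (suc i)) j)

enum-true : ∀ {n} (s : Fin n → Bool) j → s (enum s j) ≡ true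
enum-true {suc n} s j       with s zero in eq
enum-true {suc n} s zero    | true  = eq
enum-true {suc n} s (suc j) | true  = enum-true (λ i → s (suc i)) j
enum-true {suc n} s j       | false = enum-true (λ i → s (suc i)) j

enum-injective : ∀ {n} (s : Fin n → Bool) j j′ → enum s j ≡ enum s j′ → j ≡ j′
enum-injective {suc n} s j       j′       e with s zero
enum-injective {suc n} s zero    zero     e | true  = refl
enum-injective {suc n} s (suc j) (suc j′) e | true  = cong suc (enum-injective (λ i → s (suc i)) j j′ (FinP.suc-injective e))
enum-injective {suc n} s j       j′       e | false = enum-injective (λ i → s (suc i)) j j′ (FinP.suc-injective e)

index : ∀ {n} (s : Fin n → Bool) (i : Fin n) → s i ≡ true → Fin (countTrue s)
index {suc n} s zero    p with s zero
index {suc n} s zero    p  | true  = zero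
index {suc n} s zero    () | false
index {suc n} s (suc i) p with s zero
... | true  = suc (index (λ i → s (suc i)) i p)
... | false = index (λ i → s (suc i)) i p

enum-index : ∀ {n} (s : Fin n → Bool) i p → enum s (index s i p) ≡ i
enum-index {suc n} s zero    p with s zero
enum-index {suc n} s zero    p  | true  = refl
enum-index {suc n} s zero    () | false
enum-index {suc n} s (suc i) p with s zero
... | true  = cong suc (enum-index (λ i → s (suc i)) i p)
... | false = cong suc (enum-index (λ i → s (suc i)) i p)

index-enum : ∀ {n} (s : Fin n → Bool) j p → index s (enum s j) p ≡ j
index-enum s j p = enum-injective s _ _ (enum-index s (enum s j) p)

index-cong : ∀ {n} (s : Fin n → Bool) {i i′} p p′ → i ≡ i′ → index s i p ≡ index s i′ p′
index-cong s {i} p p′ refl = enum-injective s _ _ (trans (enum-index s i p) (sym (enum-index s i p′)))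

fromDoes : ∀ {A : Set} (a? : Dec A) → does a? ≡ true → A
fromDoes (yes a) _ = a

refuteDoes : ∀ {A : Set} (a? : Dec A) → does a? ≡ false → ¬ A
refuteDoes (no ¬a) _ = ¬a

α⁺ α⁻ β⁺ β⁻ : (X : Dessin) → Fin (size X) → Fin (size X)
α⁺ X = α X ⟨$⟩ʳ_
α⁻ X = α X ⟨$⟩ˡ_
β⁺ X = β X ⟨$⟩ʳ_
β⁻ X = β X ⟨$⟩ˡ_

record IsHom (E X : Dessin) (f : Fin (size E) → Fin (size X)) : Set where
  constructor isHom
  field
    α-comm : ∀ e → f (α⁺ E e) ≡ α⁺ X (f e)
    β-comm : ∀ e → f (β⁺ E e) ≡ β⁺ X (f e)

  α⁻-comm : ∀ e → f (α⁻ E e) ≡ α⁻ X (f e)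
  α⁻-comm e = trans (sym (inverseˡ (α X))) (cong (α⁻ X) (trans (sym (α-comm (α⁻ E e))) (cong f (inverseʳ (α E)))))

  β⁻-comm : ∀ e → f (β⁻ E e) ≡ β⁻ X (f e)
  β⁻-comm e = trans (sym (inverseˡ (β X))) (cong (β⁻ X) (trans (sym (β-comm (β⁻ E e))) (cong f (inverseʳ (β E)))))

open IsHom

hom-∘ : ∀ {E X Y f g} → IsHom E X f → IsHom X Y g → IsHom E Y (g ∘ f)
hom-∘ {g = g} hf hg = isHom (λ e → trans (cong g (α-comm hf e)) (α-comm hg _))
                            (λ e → trans (cong g (β-comm hf e)) (β-comm hg _))

hom-ext : ∀ {E X f g} → (∀ e → f e ≡ g e) → IsHom E X f → IsHom E X g
hom-ext {E} {X} {f} {g} f≗g hf =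
  isHom (λ e → trans (sym (f≗g (α⁺ E e))) (trans (α-comm hf e) (cong (α⁺ X) (f≗g e))))
        (λ e → trans (sym (f≗g (β⁺ E e))) (trans (β-comm hf e) (cong (β⁺ X) (f≗g e))))

record HomAt (E X : Dessin) (x : Fin (size X)) : Set where
  constructor homAt
  field
    fun   : Fin (size E) → Fin (size X)
    hom   : IsHom E X fun
    base  : fun (edge₀ E) ≡ x

record EmbAt (E X : Dessin) (x : Fin (size X)) : Set where
  constructor embAt
  field
    fun       : Fin (size E) → Fin (size X)
    hom       : IsHom E X fun
    injective : Injective _≡_ _≡_ fun
    base      : fun (edge₀ E) ≡ x

  toHomAt : HomAt E X x
  toHomAt = homAt fun hom base

embAt-∘ : ∀ {F G Y y} (φ : EmbAt F G (edge₀ G)) → EmbAt G Y y → EmbAt F Y y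
embAt-∘ (embAt φ hφ iφ φ₀) (embAt k hk ik k₀) = embAt (k ∘ φ) (hom-∘ hφ hk) (iφ ∘ ik) (trans (cong k φ₀) k₀)

embAt-id : ∀ E → EmbAt E E (edge₀ E)
embAt-id E = embAt id (isHom (λ _ → refl) (λ _ → refl)) id refl

-- Decidability, by exhaustive search over all maps Fin n → Fin m.

extend : ∀ {n m} → Fin m → (Fin n → Fin m) → Fin (suc n) → Fin m
extend y g zero    = y
extend y g (suc i) = g i

search : ∀ n m (P : (Fin n → Fin m) → Set) → (∀ f g → (∀ i → f i ≡ g i) → P f → P g) →
         (∀ f → Dec (P f)) → Dec (Σ (Fin n → Fin m) P)
search zero    m P ext P? = map′ (λ p → empty , p) (λ { (f , pf) → ext f empty (λ ()) pf }) (P? empty)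
  where
  empty : Fin 0 → Fin m
  empty ()
search (suc n) m P ext P? =
  map′ (λ (y , g , p) → extend y g , p) (λ (f , pf) → f zero , f ∘ suc , ext f _ (λ { zero → refl ; (suc i) → refl }) pf)
    (FinP.any? λ y → search n m (P ∘ extend y)
                       (λ f g f≗g → ext (extend y f) (extend y g) λ { zero → refl ; (suc i) → f≗g i }) (P? ∘ extend y))

isHom? : ∀ E X f → Dec (IsHom E X f)
isHom? E X f = map′ (λ (a , b) → isHom a b) (λ h → α-comm h , β-comm h)
  (FinP.all? (λ e → f (α⁺ E e) FinP.≟ α⁺ X (f e)) ×-dec FinP.all? (λ e → f (β⁺ E e) FinP.≟ β⁺ X (f e)))

injective? : ∀ {a b} (f : Fin a → Fin b) → Dec (Injective _≡_ _≡_ f)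
injective? f = map′ (λ inj {x} {y} → inj x y) (λ inj x y → inj)
  (FinP.all? λ x → FinP.all? λ y → f x FinP.≟ f y →-dec x FinP.≟ y)

homAt? : ∀ E X x → Dec (HomAt E X x)
homAt? E X x = map′ (λ (f , h , b) → homAt f h b) (λ (homAt f h b) → f , h , b)
  (search (size E) (size X) (λ f → IsHom E X f × f (edge₀ E) ≡ x)
    (λ f g f≗g (h , b) → hom-ext f≗g h , trans (sym (f≗g (edge₀ E))) b)
    (λ f → isHom? E X f ×-dec f (edge₀ E) FinP.≟ x))

embAt? : ∀ E X x → Dec (EmbAt E X x)
embAt? E X x = map′ (λ (f , h , i , b) → embAt f h i b) (λ (embAt f h i b) → f , h , (λ {_} {_} → i) , b)
  (search (size E) (size X) (λ f → IsHom E X f × Injective _≡_ _≡_ f × f (edge₀ E) ≡ x)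
    (λ f g f≗g (h , i , b) → hom-ext f≗g h , (λ e → i (trans (f≗g _) (trans e (sym (f≗g _))))) ,
                            trans (sym (f≗g (edge₀ E))) b)
    (λ f → isHom? E X f ×-dec injective? f ×-dec f (edge₀ E) FinP.≟ x))

homPoint embPoint : (E X : Dessin) → Fin (size X) → Bool
homPoint E X x = does (homAt? E X x)
embPoint E X x = does (embAt? E X x)

step-map : ∀ {E X f} → IsHom E X f → ∀ {u v} → Step E u v → Step X (f u) (f v)
step-map h {u} (inj₁ refl)                = inj₁ (α-comm h u)
step-map h {u} (inj₂ (inj₁ refl))         = inj₂ (inj₁ (α⁻-comm h u))
step-map h {u} (inj₂ (inj₂ (inj₁ refl)))  = inj₂ (inj₂ (inj₁ (β-comm h u)))
step-map h {u} (inj₂ (inj₂ (inj₂ refl)))  = inj₂ (inj₂ (inj₂ (β⁻-comm h u)))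

path-map : ∀ {E X f} → IsHom E X f → ∀ {u v} → Star (Step E) u v → Star (Step X) (f u) (f v)
path-map h ε        = ε
path-map h (s ◅ ss) = step-map h s ◅ path-map h ss

image-closed : ∀ {F Y k} → IsHom F Y k → ∀ {y y′} → Star (Step Y) y y′ →
               Σ (Fin (size F)) (λ f → k f ≡ y) → Σ (Fin (size F)) (λ f → k f ≡ y′)
image-closed {F} h ε                                p          = p
image-closed {F} h (inj₁ refl ◅ ss)                 (f , refl) = image-closed h ss (α⁺ F f , α-comm h f)
image-closed {F} h (inj₂ (inj₁ refl) ◅ ss)          (f , refl) = image-closed h ss (α⁻ F f , α⁻-comm h f)
image-closed {F} h (inj₂ (inj₂ (inj₁ refl)) ◅ ss)   (f , refl) = image-closed h ss (β⁺ F f , β-comm h f)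
image-closed {F} h (inj₂ (inj₂ (inj₂ refl)) ◅ ss)   (f , refl) = image-closed h ss (β⁻ F f , β⁻-comm h f)

-- A pointed homomorphism g from an irreducible G factors through an
-- embedding k whose image contains the base point of g: its whole image lies
-- in the image of k, and injectivity of k makes the factor a homomorphism.
factor-through-embedding : ∀ {F Y G k g} → IsHom F Y k → Injective _≡_ _≡_ k → IsHom G Y g → Irreducible G →
  (f₀ : Fin (size F)) → g (edge₀ G) ≡ k f₀ →
  Σ (Fin (size G) → Fin (size F)) λ φ → (∀ e → k (φ e) ≡ g e) × IsHom G F φ × φ (edge₀ G) ≡ f₀
factor-through-embedding {F} {Y} {G} {k} {g} hk ik hg irr f₀ g₀ = φ , k∘φ≗g , hφ , ik (trans (k∘φ≗g (edge₀ G)) g₀)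
  where
  lifts : ∀ e → Σ (Fin (size F)) (λ f → k f ≡ g e)
  lifts e = image-closed hk (path-map hg (irr (edge₀ G) e)) (f₀ , sym g₀)
  φ : Fin (size G) → Fin (size F)
  φ e = proj₁ (lifts e)
  k∘φ≗g : ∀ e → k (φ e) ≡ g e
  k∘φ≗g e = proj₂ (lifts e)
  hφ : IsHom G F φ
  hφ = isHom (λ e → ik (trans (k∘φ≗g (α⁺ G e)) (trans (α-comm hg e) (trans (cong (α⁺ Y) (sym (k∘φ≗g e))) (sym (α-comm hk (φ e)))))))
             (λ e → ik (trans (k∘φ≗g (β⁺ G e)) (trans (β-comm hg e) (trans (cong (β⁺ Y) (sym (k∘φ≗g e))) (sym (β-comm hk (φ e)))))))

factor-injective : ∀ {a b c} {k : Fin a → Fin c} {g : Fin b → Fin c} (φ : Fin b → Fin a) →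
                   (∀ e → k (φ e) ≡ g e) → Injective _≡_ _≡_ g → Injective _≡_ _≡_ φ
factor-injective {k = k} φ k∘φ≗g ig {x} {y} e = ig (trans (sym (k∘φ≗g x)) (trans (cong k e) (k∘φ≗g y)))

module Product (D X : Dessin) where

  fst : Fin (size (D ⊗ X)) → Fin (size D)
  fst i = proj₁ (remQuot {size D} (size X) i)

  snd : Fin (size (D ⊗ X)) → Fin (size X)
  snd i = proj₂ (remQuot {size D} (size X) i)

  fst-combine : ∀ x y → fst (combine x y) ≡ x
  fst-combine x y = cong proj₁ (FinP.remQuot-combine {size D} {size X} x y)

  snd-combine : ∀ x y → snd (combine x y) ≡ y
  snd-combine x y = cong proj₂ (FinP.remQuot-combine {size D} {size X} x y)

  fst-hom : IsHom (D ⊗ X) D fst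
  fst-hom = isHom (λ i → fst-combine _ _) (λ i → fst-combine _ _)

  snd-hom : IsHom (D ⊗ X) X snd
  snd-hom = isHom (λ i → snd-combine _ _) (λ i → snd-combine _ _)

  pair-hom : ∀ {E f g} → IsHom E D f → IsHom E X g → IsHom E (D ⊗ X) (λ e → combine (f e) (g e))
  pair-hom {E} {f} {g} hf hg = isHom
    (λ e → trans (cong₂ combine (α-comm hf e) (α-comm hg e))
                 (sym (cong₂ (λ a b → combine (α⁺ D a) (α⁺ X b)) (fst-combine (f e) (g e)) (snd-combine (f e) (g e)))))
    (λ e → trans (cong₂ combine (β-comm hf e) (β-comm hg e))
                 (sym (cong₂ (λ a b → combine (β⁺ D a) (β⁺ X b)) (fst-combine (f e) (g e)) (snd-combine (f e) (g e)))))

  homAt-⊗ : ∀ E x y → HomAt E (D ⊗ X) (combine x y) ⇔ (HomAt E D x × HomAt E X y)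
  homAt-⊗ E x y = mk⇔
    (λ (homAt f h b) → homAt (fst ∘ f) (hom-∘ h fst-hom) (trans (cong fst b) (fst-combine x y)) ,
                       homAt (snd ∘ f) (hom-∘ h snd-hom) (trans (cong snd b) (snd-combine x y)))
    (λ (homAt f hf bf , homAt g hg bg) → homAt (λ e → combine (f e) (g e)) (pair-hom hf hg) (cong₂ combine bf bg))

homMark-⊗ : ∀ E D X → countTrue (homPoint E (D ⊗ X)) ≡ countTrue (homPoint E D) ℕ.* countTrue (homPoint E X)
homMark-⊗ E D X = countTrue-product (size D) (size X) (homPoint E D) (homPoint E X) (homPoint E (D ⊗ X))
  (λ x y → does-⇔ (Product.homAt-⊗ D X E x y) (homAt? E (D ⊗ X) (combine x y)) (homAt? E D x ×-dec homAt? E X y))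

homMark-𝟙 : ∀ E → countTrue (homPoint E 𝟙) ≡ 1
homMark-𝟙 E = countTrue-single (homPoint E 𝟙) zero
  (dec-true (homAt? E 𝟙 zero) (homAt (λ _ → zero) (isHom (λ _ → refl) (λ _ → refl)) refl))
  λ { zero z≢z → ⊥-elim (z≢z refl) }

ι : ℕ → ℚᵘ.ℚᵘ
ι k = ℚᵘ.mkℚᵘ (ℤ.+ k) 0

toℚᵘ-ℕtoℚ : ∀ k → toℚᵘ (ℕtoℚ k) ℚᵘ.≃ ι k
toℚᵘ-ℕtoℚ k = ℚP.toℚᵘ-fromℚᵘ (ι k)

ℕtoℚ-+ : ∀ a b → ℕtoℚ (a ℕ.+ b) ≡ ℕtoℚ a + ℕtoℚ b
ℕtoℚ-+ a b = ℚP.toℚᵘ-injective (ℚᵘP.≃-trans (toℚᵘ-ℕtoℚ (a ℕ.+ b)) (ℚᵘP.≃-trans ι-+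
  (ℚᵘP.≃-sym (ℚᵘP.≃-trans (ℚP.toℚᵘ-homo-+ (ℕtoℚ a) (ℕtoℚ b)) (ℚᵘP.+-cong (toℚᵘ-ℕtoℚ a) (toℚᵘ-ℕtoℚ b))))))
  where
  ι-+ : ι (a ℕ.+ b) ℚᵘ.≃ (ι a ℚᵘ.+ ι b)
  ι-+ = ℚᵘ.*≡* (cong (ℤ._* ℤ.+ 1)
          (trans (ℤP.pos-+ a b) (sym (cong₂ ℤ._+_ (ℤP.*-identityʳ (ℤ.+ a)) (ℤP.*-identityʳ (ℤ.+ b))))))

ℕtoℚ-* : ∀ a b → ℕtoℚ (a ℕ.* b) ≡ ℕtoℚ a * ℕtoℚ b
ℕtoℚ-* a b = ℚP.toℚᵘ-injective (ℚᵘP.≃-trans (toℚᵘ-ℕtoℚ (a ℕ.* b)) (ℚᵘP.≃-trans ι-*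
  (ℚᵘP.≃-sym (ℚᵘP.≃-trans (ℚP.toℚᵘ-homo-* (ℕtoℚ a) (ℕtoℚ b)) (ℚᵘP.*-cong (toℚᵘ-ℕtoℚ a) (toℚᵘ-ℕtoℚ b))))))
  where
  ι-* : ι (a ℕ.* b) ℚᵘ.≃ (ι a ℚᵘ.* ι b)
  ι-* = ℚᵘ.*≡* (cong (ℤ._* ℤ.+ 1) (ℤP.pos-* a b))

ℕtoℚ-pos : ∀ k → 1 ≤ k → ¬ ℕtoℚ k ≡ 0ℚ
ℕtoℚ-pos (suc k) _ e with ℚᵘP.≃-trans (ℚᵘP.≃-sym (toℚᵘ-ℕtoℚ (suc k))) (ℚP.toℚᵘ-cong e)
... | ℚᵘ.*≡* ()

PointPred : Set
PointPred = (X : Dessin) → Fin (size X) → Bool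

mark : PointPred → QD → ℚ
mark P []            = 0ℚ
mark P ((q , X) ∷ u) = q * ℕtoℚ (countTrue (P X)) + mark P u

homMark : Dessin → Dessin → ℚ
homMark E D = ℕtoℚ (countTrue (homPoint E D))

mark-mulBy : ∀ E D v → mark (homPoint E) (mulBy D v) ≡ homMark E D * mark (homPoint E) v
mark-mulBy E D []            = sym (ℚP.*-zeroʳ (homMark E D))
mark-mulBy E D ((q , X) ∷ v) = begin
  q * homMark E (D ⊗ X) + mark (homPoint E) (mulBy D v)
    ≡⟨ cong₂ (λ a b → q * a + b) (trans (cong ℕtoℚ (homMark-⊗ E D X)) (ℕtoℚ-* (countTrue (homPoint E D)) (countTrue (homPoint E X)))) (mark-mulBy E D v) ⟩
  q * (homMark E D * homMark E X) + homMark E D * mark (homPoint E) v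
    ≡⟨ solve 4 (λ q h x w → q :* (h :* x) :+ h :* w := h :* (q :* x :+ w)) refl q (homMark E D) (homMark E X) _ ⟩
  homMark E D * (q * homMark E X + mark (homPoint E) v) ∎
  where open ≡-Reasoning

mark-evalAt : ∀ E D p → mark (homPoint E) (evalAt p D) ≡ eval p (homMark E D)
mark-evalAt E D []       = refl
mark-evalAt E D (c ∷ cs) =
  cong₂ _+_ (trans (cong (λ z → c * ℕtoℚ z) (homMark-𝟙 E)) (ℚP.*-identityʳ c))
            (trans (mark-mulBy E D (evalAt cs D)) (cong (homMark E D *_) (mark-evalAt E D cs)))

Q : ℕ → Poly
Q N = prodₚ (map linear (applyUpTo ℕtoℚ (suc N)))

-- Q (size D) kills every hom-mark of D, since hom-marks lie in [0, size D].
homMark-Q : ∀ E D → mark (homPoint E) (evalAt (Q (size D)) D) ≡ 0ℚ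
homMark-Q E D = trans (mark-evalAt E D (Q (size D)))
  (eval-prod-root (applyUpTo ℕtoℚ (suc (size D))) (homMark E D)
    (∈-applyUpTo⁺ ℕtoℚ (s≤s (countTrue-≤ (homPoint E D)))))

-- A surjection Fin n → Fin k (given with a section) that identifies two
-- distinct points shrinks: k < n.  The section misses one of the two points.
surjection-shrinks : ∀ {n k} (c : Fin n → Fin k) (sec : Fin k → Fin n) → (∀ j → c (sec j) ≡ j) →
                     ∀ e₁ e₂ → c e₁ ≡ c e₂ → ¬ e₁ ≡ e₂ → k < n
surjection-shrinks {n} {k} c sec c∘sec e₁ e₂ c₁₂ e₁≢e₂ =
  subst₂ _<_ (countTrue-allTrue k) (countTrue-allTrue n)
    (countTrue-injection-strict (λ _ → true) (λ _ → true) sec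
      (record { maps-into = λ _ _ → refl ; injective = λ i j _ _ e → sec-injective e }) missed refl missed-not-hit)
  where
  sec-injective : ∀ {i j} → sec i ≡ sec j → i ≡ j
  sec-injective {i} {j} e = trans (sym (c∘sec i)) (trans (cong c e) (c∘sec j))
  -- sec cannot hit both e₁ and e₂, since c identifies them
  hits-one : ∀ {i j} → sec i ≡ e₁ → sec j ≡ e₂ → ⊥
  hits-one {i} {j} p q = e₁≢e₂ (trans (sym p) (trans (cong sec i≡j) q))
    where
    i≡j : i ≡ j
    i≡j = trans (sym (c∘sec i)) (trans (cong c p) (trans c₁₂ (trans (cong c (sym q)) (c∘sec j))))
  e₁-hit? = FinP.any? (λ i → sec i FinP.≟ e₁)
  missed : Fin n
  missed with e₁-hit?
  ... | yes _ = e₂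
  ... | no  _ = e₁
  missed-not-hit : ∀ i → true ≡ true → ¬ sec i ≡ missed
  missed-not-hit i _ q with e₁-hit?
  ... | yes (i′ , p) = hits-one p q
  ... | no  ¬hit     = ¬hit (i , q)

restrict-perm : ∀ {n} (s : Fin n → Bool) (π : Permutation′ n) →
                (∀ y → s y ≡ true → s (π ⟨$⟩ʳ y) ≡ true) → (∀ y → s y ≡ true → s (π ⟨$⟩ˡ y) ≡ true) →
                Permutation′ (countTrue s)
restrict-perm s π closedʳ closedˡ = permutation to from
  (λ j → trans (index-cong s _ _ (trans (cong (π ⟨$⟩ʳ_) (enum-index s _ _)) (inverseʳ π))) (index-enum s j (enum-true s j)))
  (λ j → trans (index-cong s _ _ (trans (cong (π ⟨$⟩ˡ_) (enum-index s _ _)) (inverseˡ π))) (index-enum s j (enum-true s j)))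
  where
  to from : Fin (countTrue s) → Fin (countTrue s)
  to   j = index s (π ⟨$⟩ʳ enum s j) (closedʳ _ (enum-true s j))
  from j = index s (π ⟨$⟩ˡ enum s j) (closedˡ _ (enum-true s j))

module Image {E X : Dessin} (f : Fin (size E) → Fin (size X)) (hf : IsHom E X f) where

  inImage? : ∀ y → Dec (Σ (Fin (size E)) λ e → f e ≡ y)
  inImage? y = FinP.any? (λ e → f e FinP.≟ y)

  inImage : Fin (size X) → Bool
  inImage y = does (inImage? y)

  f-inImage : ∀ e → inImage (f e) ≡ true
  f-inImage e = dec-true (inImage? (f e)) (e , refl)

  image-preserved : ∀ (h : Fin (size X) → Fin (size X)) (hE : Fin (size E) → Fin (size E)) →
                    (∀ e → f (hE e) ≡ h (f e)) → ∀ y → inImage y ≡ true → inImage (h y) ≡ true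
  image-preserved h hE comm y p with fromDoes (inImage? y) p
  ... | e , refl = dec-true (inImage? (h (f e))) (hE e , comm e)

  corestrict : Fin (size E) → Fin (countTrue inImage)
  corestrict e = index inImage (f e) (f-inImage e)

  Im : Dessin
  Im = record
    { size  = countTrue inImage
    ; edge₀ = corestrict (edge₀ E)
    ; α     = restrict-perm inImage (α X) (image-preserved (α⁺ X) (α⁺ E) (α-comm hf)) (image-preserved (α⁻ X) (α⁻ E) (α⁻-comm hf))
    ; β     = restrict-perm inImage (β X) (image-preserved (β⁺ X) (β⁺ E) (β-comm hf)) (image-preserved (β⁻ X) (β⁻ E) (β⁻-comm hf))
    }

  inclusion-embAt : EmbAt Im X (f (edge₀ E))
  inclusion-embAt = embAt (enum inImage) (isHom (λ j → enum-index inImage _ _) (λ j → enum-index inImage _ _))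
                          (enum-injective inImage _ _) (enum-index inImage _ _)

  corestrict-hom : IsHom E Im corestrict
  corestrict-hom = isHom
    (λ e → index-cong inImage _ _ (trans (α-comm hf e) (cong (α⁺ X) (sym (enum-index inImage _ _)))))
    (λ e → index-cong inImage _ _ (trans (β-comm hf e) (cong (β⁺ X) (sym (enum-index inImage _ _)))))

  preimage : Fin (size Im) → Fin (size E)
  preimage j = proj₁ (fromDoes (inImage? (enum inImage j)) (enum-true inImage j))

  corestrict-preimage : ∀ j → corestrict (preimage j) ≡ j
  corestrict-preimage j =
    trans (index-cong inImage _ (enum-true inImage j) (proj₂ (fromDoes (inImage? (enum inImage j)) (enum-true inImage j))))
          (index-enum inImage j (enum-true inImage j))

  Im-irreducible : Irreducible E → Irreducible Im
  Im-irreducible irr j j′ =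
    subst₂ (Star (Step Im)) (corestrict-preimage j) (corestrict-preimage j′)
      (path-map corestrict-hom (irr (preimage j) (preimage j′)))

  Im-smaller : ∀ e₁ e₂ → f e₁ ≡ f e₂ → ¬ e₁ ≡ e₂ → size Im < size E
  Im-smaller e₁ e₂ f₁₂ = surjection-shrinks corestrict preimage corestrict-preimage e₁ e₂ (index-cong inImage _ _ f₁₂)

_∧ₚ_ : PointPred → PointPred → PointPred
(P ∧ₚ Q) X x = P X x ∧ Q X x

notₚ : PointPred → PointPred
notₚ P X x = not (P X x)

mark-ext : ∀ P P′ u → (∀ X x → P X x ≡ P′ X x) → mark P u ≡ mark P′ u
mark-ext P P′ []            e = refl
mark-ext P P′ ((q , X) ∷ u) e =
  cong₂ (λ a b → q * ℕtoℚ a + b) (countTrue-ext (P X) (P′ X) (e X)) (mark-ext P P′ u e)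

mark-split : ∀ P Q u → mark P u ≡ mark (P ∧ₚ Q) u + mark (P ∧ₚ notₚ Q) u
mark-split P Q []            = sym (ℚP.+-identityˡ 0ℚ)
mark-split P Q ((q , X) ∷ u) = begin
  q * ℕtoℚ (countTrue (P X)) + mark P u
    ≡⟨ cong₂ (λ a b → q * a + b) (trans (cong ℕtoℚ (countTrue-split (P X) (Q X))) (ℕtoℚ-+ a b)) (mark-split P Q u) ⟩
  q * (ℕtoℚ a + ℕtoℚ b) + (mark (P ∧ₚ Q) u + mark (P ∧ₚ notₚ Q) u)
    ≡⟨ solve 5 (λ q a b c d → q :* (a :+ b) :+ (c :+ d) := (q :* a :+ c) :+ (q :* b :+ d)) refl q (ℕtoℚ a) (ℕtoℚ b) _ _ ⟩
  (q * ℕtoℚ a + mark (P ∧ₚ Q) u) + (q * ℕtoℚ b + mark (P ∧ₚ notₚ Q) u) ∎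
  where
  open ≡-Reasoning
  a = countTrue (λ i → P X i ∧ Q X i)
  b = countTrue (λ i → P X i ∧ not (Q X i))

support : PointPred → QD → ℕ
support P []            = 0
support P ((q , X) ∷ u) = countTrue (P X) ℕ.+ support P u

support-split : ∀ P Q u → support P u ≡ support (P ∧ₚ Q) u ℕ.+ support (P ∧ₚ notₚ Q) u
support-split P Q []            = refl
support-split P Q ((q , X) ∷ u) =
  trans (cong₂ ℕ._+_ (countTrue-split (P X) (Q X)) (support-split P Q u))
    (+-interchange (countTrue ((P ∧ₚ Q) X)) (countTrue ((P ∧ₚ notₚ Q) X)) (support (P ∧ₚ Q) u) (support (P ∧ₚ notₚ Q) u))

support-zero : ∀ P u → support P u ≡ 0 → mark P u ≡ 0ℚ
support-zero P []            _ = refl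
support-zero P ((q , X) ∷ u) s≡0 = begin
  q * ℕtoℚ (countTrue (P X)) + mark P u ≡⟨ cong₂ (λ a b → q * ℕtoℚ a + b) (ℕP.m+n≡0⇒m≡0 (countTrue (P X)) s≡0) (support-zero P u (ℕP.m+n≡0⇒n≡0 (countTrue (P X)) s≡0)) ⟩
  q * 0ℚ + 0ℚ                           ≡⟨ trans (ℚP.+-identityʳ _) (ℚP.*-zeroʳ q) ⟩
  0ℚ                                    ∎
  where open ≡-Reasoning

record Selected (P : PointPred) (u : QD) : Set where
  field
    X        : Dessin
    x        : Fin (size X)
    selected : P X x ≡ true
    counted  : ∀ Q → Q X x ≡ true → 1 ≤ support (P ∧ₚ Q) u

selected-or-empty : ∀ P u → support P u ≡ 0 ⊎ Selected P u
selected-or-empty P [] = inj₁ refl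
selected-or-empty P ((q , X) ∷ u) with FinP.any? (λ x → P X x BoolP.≟ true)
... | yes (x , Px) = inj₂ record
  { X = X ; x = x ; selected = Px
  ; counted = λ Q Qx → ℕP.≤-trans (countTrue-pos (λ i → P X i ∧ Q X i) x (∧-true Px Qx)) (ℕP.m≤m+n _ _) }
... | no none with selected-or-empty P u
...   | inj₂ s = inj₂ record
  { X = X′ ; x = x′ ; selected = selected
  ; counted = λ Q Qx → ℕP.≤-trans (counted Q Qx) (ℕP.m≤n+m _ _) }
  where open Selected s renaming (X to X′; x to x′)
...   | inj₁ s≡0 = inj₁ (trans (cong (ℕ._+ support P u) (countTrue-allFalse (P X) none′)) s≡0)
  where
  none′ : ∀ x → P X x ≡ false
  none′ x with P X x in Px
  ... | true  = ⊥-elim (none (x , Px))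
  ... | false = refl

-- If an irreducible F and some F′ embed at the same edge, then F embeds at
-- every edge where F′ does: F factors through F′ there.
embAt-transfer : ∀ {F F′ Z z Y y} → Irreducible F → EmbAt F Z z → EmbAt F′ Z z → EmbAt F′ Y y → EmbAt F Y y
embAt-transfer {F} {F′} irr (embAt k hk ik k₀) (embAt k′ hk′ ik′ k′₀) F′↪Y =
  embAt-∘ (embAt φ hφ (factor-injective {k = k′} φ k′∘φ≗k ik) φ₀) F′↪Y
  where
  factor = factor-through-embedding hk′ ik′ hk irr (edge₀ F′) (trans k₀ (sym k′₀))
  φ = proj₁ factor
  k′∘φ≗k = proj₁ (proj₂ factor)
  hφ = proj₁ (proj₂ (proj₂ factor))
  φ₀ = proj₂ (proj₂ (proj₂ factor))

record Cover (n : ℕ) (P : PointPred) (X : Dessin) (x : Fin (size X)) : Set where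
  field
    F           : Dessin
    irreducible : Irreducible F
    smaller     : size F < n
    embeds      : EmbAt F X x
    saturated   : ∀ Y y → EmbAt F Y y → P Y y ≡ true

Covered : ℕ → PointPred → Set
Covered n P = ∀ X x → P X x ≡ true → Cover n P X x

covered-remove : ∀ {n P} F → Irreducible F → Covered n P → Covered n (P ∧ₚ notₚ (embPoint F))
covered-remove {n} {P} F irr covered Y y Py∧¬Fy = record
  { F = F′ ; irreducible = irreducible ; smaller = smaller ; embeds = embeds
  ; saturated = λ Z z F′↪Z → ∧-true (saturated Z z F′↪Z)
                  (not-false (dec-false (embAt? F Z z) λ F↪Z → ¬F↪Y (embAt-transfer irr F↪Z F′↪Z embeds))) }
  where
  open Cover (covered Y y (BoolP.∧-conicalˡ (P Y y) _ Py∧¬Fy)) renaming (F to F′)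
  ¬F↪Y : ¬ EmbAt F Y y
  ¬F↪Y = refuteDoes (embAt? F Y y) (BoolP.not-injective (BoolP.∧-conicalʳ (P Y y) _ Py∧¬Fy))

-- A covered predicate has vanishing mark on u once all embedding marks at
-- the smaller irreducibles vanish: peel off the embedding points of the
-- cover of a selected edge until nothing is selected.
covered-mark-zero : ∀ u n → (∀ F → Irreducible F → size F < n → mark (embPoint F) u ≡ 0ℚ) →
                    ∀ fuel P → support P u ≤ fuel → Covered n P → mark P u ≡ 0ℚ
covered-mark-zero u n small-zero zero P s≤0 covered = support-zero P u (ℕP.n≤0⇒n≡0 s≤0)
covered-mark-zero u n small-zero (suc fuel) P s≤fuel covered with selected-or-empty P u
... | inj₁ s≡0 = support-zero P u s≡0
... | inj₂ sel = begin
  mark P u                                                ≡⟨ mark-split P (embPoint F) u ⟩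
  mark (P ∧ₚ embPoint F) u + mark (P ∧ₚ notₚ (embPoint F)) u ≡⟨ cong₂ _+_ class-zero rest-zero ⟩
  0ℚ + 0ℚ                                                 ≡⟨ ℚP.+-identityˡ 0ℚ ⟩
  0ℚ                                                      ∎
  where
  open ≡-Reasoning
  open Selected sel
  open Cover (covered X x selected)
  -- the embedding points of F are all selected, so this part is the embedding mark
  class-zero : mark (P ∧ₚ embPoint F) u ≡ 0ℚ
  class-zero = trans (mark-ext _ (embPoint F) u class) (small-zero F irreducible smaller)
    where
    class : ∀ Y y → (P Y y ∧ embPoint F Y y) ≡ embPoint F Y y
    class Y y with embPoint F Y y in F↪Y
    ... | true  = trans (BoolP.∧-identityʳ (P Y y)) (saturated Y y (fromDoes (embAt? F Y y) F↪Y))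
    ... | false = BoolP.∧-zeroʳ (P Y y)
  rest-smaller : support (P ∧ₚ notₚ (embPoint F)) u ≤ fuel
  rest-smaller = ℕP.+-cancelˡ-≤ 1 _ _ (ℕP.≤-trans
    (ℕP.+-monoˡ-≤ _ (counted (embPoint F) (dec-true (embAt? F X x) embeds)))
    (ℕP.≤-trans (ℕP.≤-reflexive (sym (support-split P (embPoint F) u))) s≤fuel))
  rest-zero : mark (P ∧ₚ notₚ (embPoint F)) u ≡ 0ℚ
  rest-zero = covered-mark-zero u n small-zero fuel _ rest-smaller (covered-remove F irreducible covered)

non-injective : ∀ {a b} (f : Fin a → Fin b) → ¬ Injective _≡_ _≡_ f →
                Σ (Fin a) λ e₁ → Σ (Fin a) λ e₂ → f e₁ ≡ f e₂ × ¬ e₁ ≡ e₂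
non-injective f ¬inj
  with FinP.any? (λ e₁ → FinP.any? (λ e₂ → (f e₁ FinP.≟ f e₂) ×-dec ¬? (e₁ FinP.≟ e₂)))
... | yes (e₁ , e₂ , collide , distinct) = e₁ , e₂ , collide , distinct
... | no none = ⊥-elim (¬inj λ {x} {y} fx≡fy → decide (x FinP.≟ y) fx≡fy)
  where
  decide : ∀ {x y} → Dec (x ≡ y) → f x ≡ f y → x ≡ y
  decide (yes x≡y)         _     = x≡y
  decide {x} {y} (no x≢y) fx≡fy = ⊥-elim (none (x , y , fx≡fy , x≢y))

-- The edges where E maps in but does not embed are covered by the images of
-- the non-injective homomorphisms, which are smaller irreducible dessins.
nonembedding-cover : ∀ E → Irreducible E → ∀ {X x} → HomAt E X x → ¬ EmbAt E X x →
                     Cover (size E) (homPoint E ∧ₚ notₚ (embPoint E)) X x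
nonembedding-cover E irr {X} (homAt f hf f₀) ¬E↪X = record
  { F = Im ; irreducible = Im-irreducible irr ; smaller = smaller
  ; embeds = subst (EmbAt Im X) f₀ inclusion-embAt ; saturated = saturated }
  where
  open Image f hf
  smaller : size Im < size E
  smaller with non-injective f (λ inj → ¬E↪X (embAt f hf inj f₀))
  ... | e₁ , e₂ , collide , distinct = Im-smaller e₁ e₂ collide distinct
  -- an embedding E ↪ Y through a point of Im would factor injectively through Im
  no-embedding : ∀ {Y y} → EmbAt Im Y y → ¬ EmbAt E Y y
  no-embedding (embAt k hk ik k₀) (embAt g hg ig g₀) =
    ℕP.<⇒≱ smaller (FinP.injective⇒≤ (factor-injective {k = k} (proj₁ factor) (proj₁ (proj₂ factor)) ig))
    where factor = factor-through-embedding hk ik hg irr (edge₀ Im) (trans g₀ (sym k₀))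
  saturated : ∀ Y y → EmbAt Im Y y → (homPoint E Y y ∧ not (embPoint E Y y)) ≡ true
  saturated Y y Im↪Y@(embAt k hk ik k₀) = ∧-true
    (dec-true (homAt? E Y y) (homAt (k ∘ corestrict) (hom-∘ corestrict-hom hk) k₀))
    (not-false (dec-false (embAt? E Y y) (no-embedding Im↪Y)))

nonembedding-covered : ∀ E → Irreducible E → Covered (size E) (homPoint E ∧ₚ notₚ (embPoint E))
nonembedding-covered E irr X x hom∧¬emb = nonembedding-cover E irr
  (fromDoes (homAt? E X x) (BoolP.∧-conicalˡ (homPoint E X x) _ hom∧¬emb))
  (refuteDoes (embAt? E X x) (BoolP.not-injective (BoolP.∧-conicalʳ (homPoint E X x) _ hom∧¬emb)))

-- By strong induction on the size of E: the hom-mark at E is the embedding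
-- mark at E plus the mark of a predicate covered by smaller irreducibles.
embMarks-zero : ∀ u → (∀ E → Irreducible E → mark (homPoint E) u ≡ 0ℚ) →
                ∀ n E → Irreducible E → size E < n → mark (embPoint E) u ≡ 0ℚ
embMarks-zero u homs-zero (suc n) E irr (s≤s size≤n) = begin
  mark (embPoint E) u                                                   ≡⟨ mark-ext _ _ u emb⊆hom ⟩
  mark (homPoint E ∧ₚ embPoint E) u                                     ≡⟨ sym (ℚP.+-identityʳ _) ⟩
  mark (homPoint E ∧ₚ embPoint E) u + 0ℚ                                ≡⟨ cong (mark (homPoint E ∧ₚ embPoint E) u +_) (sym nonembedding-zero) ⟩
  mark (homPoint E ∧ₚ embPoint E) u + mark (homPoint E ∧ₚ notₚ (embPoint E)) u ≡⟨ sym (mark-split (homPoint E) (embPoint E) u) ⟩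
  mark (homPoint E) u                                                   ≡⟨ homs-zero E irr ⟩
  0ℚ                                                                    ∎
  where
  open ≡-Reasoning
  emb⊆hom : ∀ X x → embPoint E X x ≡ (homPoint E X x ∧ embPoint E X x)
  emb⊆hom X x with embPoint E X x in E↪X
  ... | true  = sym (trans (BoolP.∧-identityʳ _) (dec-true (homAt? E X x) (EmbAt.toHomAt (fromDoes (embAt? E X x) E↪X))))
  ... | false = sym (BoolP.∧-zeroʳ _)
  nonembedding-zero : mark (homPoint E ∧ₚ notₚ (embPoint E)) u ≡ 0ℚ
  nonembedding-zero = covered-mark-zero u (size E)
    (λ F irrF F<E → embMarks-zero u homs-zero n F irrF (ℕP.≤-trans F<E size≤n))
    _ _ ℕP.≤-refl (nonembedding-covered E irr)

module Iso {D D′ : Dessin} (iso : D ≅ D′) where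
  open _≅_ iso

  to : Fin (size D) → Fin (size D′)
  to = Inverse.to f

  from : Fin (size D′) → Fin (size D)
  from = Inverse.from f

  to-hom : IsHom D D′ to
  to-hom = isHom f-α f-β

  from-hom : IsHom D′ D from
  from-hom = isHom (λ e → trans (cong from (cong (α⁺ D′) (sym (inverseʳ f)))) (trans (cong from (sym (f-α (from e)))) (inverseˡ f)))
                   (λ e → trans (cong from (cong (β⁺ D′) (sym (inverseʳ f)))) (trans (cong from (sym (f-β (from e)))) (inverseˡ f)))

  to-injective : Injective _≡_ _≡_ to
  to-injective {i} {j} q = trans (sym (inverseˡ f)) (trans (cong from q) (inverseˡ f))

  from-injective : Injective _≡_ _≡_ from
  from-injective {i} {j} q = trans (sym (inverseʳ f)) (trans (cong to q) (inverseʳ f))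

  embMark-≅ : ∀ E → countTrue (embPoint E D) ≡ countTrue (embPoint E D′)
  embMark-≅ E = countTrue-bijection (embPoint E D) (embPoint E D′) to from
    (record { maps-into = λ e p → dec-true (embAt? E D′ (to e)) (transport to-hom to-injective (fromDoes (embAt? E D e) p))
            ; injective = λ _ _ _ _ → to-injective })
    (record { maps-into = λ e p → dec-true (embAt? E D (from e)) (transport from-hom from-injective (fromDoes (embAt? E D′ e) p))
            ; injective = λ _ _ _ _ → from-injective })
    where
    transport : ∀ {A B k x} → IsHom A B k → Injective _≡_ _≡_ k → EmbAt E A x → EmbAt E B (k x)
    transport {k = k} hk ik (embAt g hg ig g₀) = embAt (k ∘ g) (hom-∘ hg hk) (ig ∘ ik) (cong k g₀)

-- an embedding of an irreducible-target dessin is onto, hence an isomorphism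
embedding-≅ : ∀ {E D} → Irreducible D → (g : Fin (size E) → Fin (size D)) → IsHom E D g → Injective _≡_ _≡_ g → D ≅ E
embedding-≅ {E} {D} irr g hg ig = record
  { f   = permutation to g (λ y → ig (g∘to (g y))) g∘to
  ; f-α = λ c → ig (trans (g∘to (α⁺ D c)) (trans (cong (α⁺ D) (sym (g∘to c))) (sym (α-comm hg (to c)))))
  ; f-β = λ c → ig (trans (g∘to (β⁺ D c)) (trans (cong (β⁺ D) (sym (g∘to c))) (sym (β-comm hg (to c))))) }
  where
  onto : ∀ c → Σ (Fin (size E)) λ e → g e ≡ c
  onto c = image-closed hg (irr (g (edge₀ E)) c) (edge₀ E , refl)
  to : Fin (size D) → Fin (size E)
  to c = proj₁ (onto c)
  g∘to : ∀ c → g (to c) ≡ c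
  g∘to c = proj₂ (onto c)

countTrue-partition : ∀ {N} c (ins : Fin c → Fin N → Bool) (t : Fin N → Bool) →
  (∀ x → t x ≡ true → Σ (Fin c) λ i → ins i x ≡ true) →
  (∀ i j x → ins i x ≡ true → ins j x ≡ true → i ≡ j) →
  countTrue t ≡ sumFin c (λ i → countTrue (λ x → t x ∧ ins i x))
countTrue-partition zero ins t cover disjoint = countTrue-allFalse t uncovered
  where
  uncovered : ∀ x → t x ≡ false
  uncovered x with t x in tx
  ... | false = refl
  ... | true  with () ← proj₁ (cover x tx)
countTrue-partition (suc c) ins t cover disjoint =
  trans (countTrue-split t (ins zero))
    (cong (countTrue (λ x → t x ∧ ins zero x) ℕ.+_)
      (trans (countTrue-partition c (ins ∘ suc) t′ cover′ (λ i j x p q → FinP.suc-injective (disjoint (suc i) (suc j) x p q)))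
        (sumFin-ext c _ _ λ i → countTrue-ext _ _ λ x → drop-zero i x)))
  where
  t′ = λ x → t x ∧ not (ins zero x)
  cover′ : ∀ x → t′ x ≡ true → Σ (Fin c) λ i → ins (suc i) x ≡ true
  cover′ x p with cover x (BoolP.∧-conicalˡ (t x) _ p)
  ... | zero  , q = ⊥-elim (excluded q (BoolP.∧-conicalʳ (t x) _ p))
    where
    excluded : ∀ {b} → b ≡ true → not b ≡ true → ⊥
    excluded refl ()
  ... | suc i , q = i , q
  -- on the later pieces, the exclusion of the first piece is vacuous
  drop-zero : ∀ i x → (t′ x ∧ ins (suc i) x) ≡ (t x ∧ ins (suc i) x)
  drop-zero i x with ins (suc i) x in in-i
  ... | false = trans (BoolP.∧-zeroʳ _) (sym (BoolP.∧-zeroʳ _))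
  ... | true with ins zero x in in-0
  ...   | true  with () ← disjoint zero (suc i) x in-0 in-i
  ...   | false = cong (_∧ true) (BoolP.∧-identityʳ (t x))

-- counting t-edges in the image of an injective map = counting along the map
-- (a default point of the domain makes the inverse map total)
countTrue-image : ∀ {m N} (emb : Fin m → Fin N) → Injective _≡_ _≡_ emb → Fin m → (t : Fin N → Bool) →
  countTrue (λ x → t x ∧ does (FinP.any? (λ e → emb e FinP.≟ x))) ≡ countTrue (t ∘ emb)
countTrue-image {m} {N} emb emb-inj default t = sym (countTrue-bijection (t ∘ emb) t∧im emb back
  (record { maps-into = λ e p → ∧-true p (dec-true (inImage? (emb e)) (e , refl))
          ; injective = λ _ _ _ _ → emb-inj })
  (record { maps-into = λ x p → subst (λ z → t z ≡ true) (sym (emb∘back x p)) (BoolP.∧-conicalˡ (t x) _ p)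
          ; injective = λ x y p q e → trans (sym (emb∘back x p)) (trans (cong emb e) (emb∘back y q)) }))
  where
  inImage? : ∀ x → Dec (Σ (Fin m) λ e → emb e ≡ x)
  inImage? x = FinP.any? (λ e → emb e FinP.≟ x)
  t∧im = λ x → t x ∧ does (inImage? x)
  back : Fin N → Fin m
  back x with inImage? x
  ... | yes (e , _) = e
  ... | no  _       = default
  emb∘back : ∀ x → t x ∧ does (inImage? x) ≡ true → emb (back x) ≡ x
  emb∘back x p with inImage? x
  ... | yes (e , q) = q
  ... | no  _       with () ← trans (sym (BoolP.∧-zeroʳ (t x))) p

module ComponentMarks {E X : Dessin} (irrE : Irreducible E) (C : Component X) where
  open Component C renaming (dessin to D)

  emb-hom : IsHom D X emb
  emb-hom = isHom emb-α emb-β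

  -- E embeds into X at a point of D iff it embeds into D there: an
  -- embedding into X based in D lands in D since E is irreducible.
  embPoint-emb : ∀ e → embPoint E X (emb e) ≡ embPoint E D e
  embPoint-emb e = does-⇔ (mk⇔ restrict widen) (embAt? E X (emb e)) (embAt? E D e)
    where
    restrict : EmbAt E X (emb e) → EmbAt E D e
    restrict (embAt g hg ig g₀) =
      let (φ , emb∘φ≗g , hφ , φ₀) = factor-through-embedding emb-hom emb-inj hg irrE e g₀
      in embAt φ hφ (factor-injective {k = emb} φ emb∘φ≗g ig) φ₀
    widen : EmbAt E D e → EmbAt E X (emb e)
    widen (embAt g hg ig g₀) = embAt (emb ∘ g) (hom-∘ hg emb-hom) (ig ∘ emb-inj) (cong emb g₀)

  embMark-component : ∀ (b : Bool) → (b ≡ true ⇔ D ≅ E) →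
                      countTrue (embPoint E X ∘ emb) ≡ (if b then countTrue (embPoint E E) else 0)
  embMark-component true  iff = trans (countTrue-ext _ _ embPoint-emb) (Iso.embMark-≅ (Equivalence.to iff refl) E)
  embMark-component false iff = trans (countTrue-ext _ _ embPoint-emb) (countTrue-allFalse _ none)
    where
    none : ∀ e → embPoint E D e ≡ false
    none e = dec-false (embAt? E D e) λ (embAt g hg ig _) →
      case (Equivalence.from iff (embedding-≅ irreducible g hg ig))
      where
      case : false ≡ true → ⊥
      case ()

embMark-multiplicity : ∀ E X k → Irreducible E → MultIs E X k → countTrue (embPoint E X) ≡ k ℕ.* countTrue (embPoint E E)
embMark-multiplicity E X k irrE (dec , s , iff , count≡k) = begin
  countTrue (embPoint E X)
    ≡⟨ countTrue-partition count inComp (embPoint E X) (λ x _ → inComp-cover x) inComp-disjoint ⟩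
  sumFin count (λ i → countTrue (λ x → embPoint E X x ∧ inComp i x))
    ≡⟨ sumFin-ext count _ _ (λ i → trans
         (countTrue-image (Component.emb (comp i)) (Component.emb-inj (comp i)) (edge₀ (Component.dessin (comp i))) (embPoint E X))
         (ComponentMarks.embMark-component irrE (comp i) (s i) (iff i))) ⟩
  sumFin count (λ i → if s i then countTrue (embPoint E E) else 0)
    ≡⟨ sumFin-if count s _ ⟩
  countTrue s ℕ.* countTrue (embPoint E E)
    ≡⟨ cong (ℕ._* countTrue (embPoint E E)) count≡k ⟩
  k ℕ.* countTrue (embPoint E E) ∎
  where
  open ≡-Reasoning
  open Decomposition dec
  inComp? : ∀ i x → Dec (Σ (Fin (size (Component.dessin (comp i)))) λ e → Component.emb (comp i) e ≡ x)
  inComp? i x = FinP.any? (λ e → Component.emb (comp i) e FinP.≟ x)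
  inComp : Fin count → Fin (size X) → Bool
  inComp i x = does (inComp? i x)
  inComp-cover : ∀ x → Σ (Fin count) λ i → inComp i x ≡ true
  inComp-cover x = proj₁ (cover x) , dec-true (inComp? (proj₁ (cover x)) x) (proj₂ (cover x))
  inComp-disjoint : ∀ i j x → inComp i x ≡ true → inComp j x ≡ true → i ≡ j
  inComp-disjoint i j x p q with fromDoes (inComp? i x) p | fromDoes (inComp? j x) q
  ... | (e , e↦x) | (e′ , e′↦x) = disjoint i j e e′ (trans e↦x (sym e′↦x))

coefficient-embMark : ∀ E u c → Irreducible E → CoeffIs E u c →
                      ℕtoℚ (countTrue (embPoint E E)) * c ≡ mark (embPoint E) u
coefficient-embMark E [] .0ℚ irr nil = ℚP.*-zeroʳ (ℕtoℚ (countTrue (embPoint E E)))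
coefficient-embMark E ((q , X) ∷ u) .(q * ℕtoℚ k + c) irr (cons {c = c} {k = k} mult rest) = begin
  a * (q * ℕtoℚ k + c)                       ≡⟨ solve 4 (λ a q k c → a :* (q :* k :+ c) := q :* (k :* a) :+ a :* c) refl a q (ℕtoℚ k) c ⟩
  q * (ℕtoℚ k * a) + a * c                   ≡⟨ cong₂ (λ m w → q * m + w) (sym embMark-X) (coefficient-embMark E u c irr rest) ⟩
  q * ℕtoℚ (countTrue (embPoint E X)) + mark (embPoint E) u ∎
  where
  open ≡-Reasoning
  a = ℕtoℚ (countTrue (embPoint E E))
  embMark-X : ℕtoℚ (countTrue (embPoint E X)) ≡ ℕtoℚ k * a
  embMark-X = trans (cong ℕtoℚ (embMark-multiplicity E X k irr mult)) (ℕtoℚ-* k (countTrue (embPoint E E)))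

-- Q (size D) annihilates D: all hom-marks of Q(D) vanish, hence all embedding
-- marks, hence all coefficients since E embeds into itself.
Q-annihilates : ∀ D → Annihilates (Q (size D)) D
Q-annihilates D E irr c coeff-c with c ℚP.≟ 0ℚ
... | yes c≡0 = c≡0
... | no  c≢0 = ⊥-elim (*-nonzero (ℕtoℚ (countTrue (embPoint E E))) c (ℕtoℚ-pos _ self-embeds) c≢0 (trans (coefficient-embMark E u c irr coeff-c) emb-zero))
  where
  u = evalAt (Q (size D)) D
  emb-zero : mark (embPoint E) u ≡ 0ℚ
  emb-zero = embMarks-zero u (λ E′ _ → homMark-Q E′ D) (suc (size E)) E irr ℕP.≤-refl
  self-embeds : 1 ≤ countTrue (embPoint E E)
  self-embeds = countTrue-pos (embPoint E E) (edge₀ E) (dec-true (embAt? E E (edge₀ E)) (embAt-id E))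

mainTheorem1 : (D : Dessin) → Irreducible D → (P : Poly) → IsMinPoly P D → SplitsOverℚ P
mainTheorem1 D irr P (monic , annihilates , divides-annihilators) =
  monic-divisor-splits (applyUpTo ℕtoℚ (suc (size D))) P monic (divides-annihilators (Q (size D)) (Q-annihilates D))
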